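{- For $\mu,\lambda\in\mathbb{Z}\Phi^\vee$, $t_\mu \le_a t_\lambda$ if and only if $\mu\preceq\lambda$.
   Context: $\Phi$ is an irreducible, reduced, crystallographic root system in a Euclidean space $E$ of dimension $r$ with inner product $(\cdot|\cdot)$; $\alpha^\vee = 2\alpha/(\alpha|\alpha)$; $\mathbb{Z}\Phi^\vee$ is the coroot lattice; simple roots $\alpha_1,\dots,\alpha_r$, positive roots $\Phi^+$. $s_{\alpha,k}(v) = v + (k-(v|\alpha))\alpha^\vee$ is the reflection in $H_{\alpha,k} = \{x:(x|\alpha)=k\}$; the affine Weyl group $W$ is the group generated by all $s_{\alpha,k}$ ($\alpha\in\Phi^+$, $k\in\mathbb{Z}$); $t_\mu\in W$ is translation by $\mu\in\mathbb{Z}\Phi^\vee$. Alcoves are connected components of $E\setminus\bigcup H_{\alpha,k}$; $A_+ = \{x : 0<(x|\alpha)<1\ \forall\alpha\in\Phi^+\}$ and $A_w = wA_+$. $\mu\preceq\lambda$ means $\lambda-\mu$ is a nonnegative combination of $\alpha_1^\vee,\dots,\alpha_r^\vee$. The affine order: for $x,y\in W$, $y\le_a x$ if there are $y=y_0,y_1,\dots,y_n=x$ in $W$ and affine reflections $s_{\beta_i,k_i}$ ($\beta_i\in\Phi^+$, $k_i\in\mathbb{Z}$) with $s_{\beta_i,k_i}y_i = y_{i-1}$ and $(u_i|\beta_i) > k_i$ for all $u_i\in A_{y_i}$, for each $i$.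
   Formalization: The space $E$ is taken as ℚ^r, with the inner product $(\cdot|\cdot)$ given by a symmetric positive definite rational Gram matrix, so alcoves and the affine order involve rational points. -}

module Defs where

open import Data.Nat using (ℕ; zero; suc)
open import Data.Integer using (ℤ; +_; -[1+_]; +[1+_])
open import Data.Rational using (ℚ; mkℚ; 0ℚ; 1ℚ; _+_; _*_; _-_; -_; 1/_; _<_; _/_)
open import Data.Fin using (Fin; zero; suc)
open import Data.Vec using (Vec; zipWith; map; replicate; lookup)
open import Data.List using (List; []; _∷_)
open import Data.List.Membership.Propositional using (_∈_; _∉_)
open import Data.List.Relation.Unary.All using (All)
open import Data.Product using (Σ; ∃; _×_; _,_; proj₁; proj₂)
open import Data.Sum using (_⊎_)
open import Data.Bool using (Bool)
open import Relation.Binary.PropositionalEquality using (_≡_; _≢_)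

-- The Euclidean space E, modelled by its rational points ℚ^r
--.

V : ℕ → Set
V r = Vec ℚ r

𝟘 : ∀ {r} → V r
𝟘 = replicate _ 0ℚ

_⊕_ : ∀ {r} → V r → V r → V r
u ⊕ v = zipWith _+_ u v

_⊖_ : ∀ {r} → V r → V r → V r
u ⊖ v = zipWith _-_ u v

_·_ : ∀ {r} → ℚ → V r → V r
c · v = map (c *_) v

ΣF : ∀ {A : Set} (r : ℕ) → (A → A → A) → A → (Fin r → A) → A
ΣF zero    _ e f = e
ΣF (suc r) o e f = o (f zero) (ΣF r o e (λ i → f (suc i)))

ΣQ : (r : ℕ) → (Fin r → ℚ) → ℚ
ΣQ r = ΣF r _+_ 0ℚ

ΣV : ∀ {r} (n : ℕ) → (Fin n → V r) → V r
ΣV n = ΣF n _⊕_ 𝟘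

ℤ→ℚ : ℤ → ℚ
ℤ→ℚ z = z / 1

ℕ→ℚ : ℕ → ℚ
ℕ→ℚ n = (+ n) / 1

-- total inverse (0 ↦ 0); only ever applied to (α|α) > 0
inv : ℚ → ℚ
inv q@(mkℚ (+ 0) _ _)     = 0ℚ
inv q@(mkℚ +[1+ n ] _ _)  = 1/ q
inv q@(mkℚ -[1+ n ] _ _)  = 1/ q

2ℚ : ℚ
2ℚ = (+ 2) / 1

record RootSystem (r : ℕ) : Set where
  field
    G        : Fin r → Fin r → ℚ
  ⟨_∣_⟩ : V r → V r → ℚ
  ⟨ u ∣ v ⟩ = ΣQ r (λ i → ΣQ r (λ j → lookup u i * (G i j * lookup v j)))
  coroot : V r → V r
  coroot α = (2ℚ * inv ⟨ α ∣ α ⟩) · α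
  refl₀ : V r → V r → V r
  refl₀ α v = v ⊖ (⟨ v ∣ α ⟩ · coroot α)
  field
    G-sym    : ∀ i j → G i j ≡ G j i
    G-posdef : ∀ v → v ≢ 𝟘 → 0ℚ < ⟨ v ∣ v ⟩
    Φ        : List (V r)
    Φ-nonzero : 𝟘 ∉ Φ
    Φ-span   : ∀ v → ∃ λ (c : List (ℚ × V r)) → All (λ p → proj₂ p ∈ Φ) c
                 × v ≡ Data.List.foldr (λ p acc → (proj₁ p · proj₂ p) ⊕ acc) 𝟘 c
    Φ-refl   : ∀ {α β} → α ∈ Φ → β ∈ Φ → refl₀ α β ∈ Φ
    Φ-cryst  : ∀ {α β} → α ∈ Φ → β ∈ Φ → ∃ λ (z : ℤ) → ⟨ β ∣ coroot α ⟩ ≡ ℤ→ℚ z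
    Φ-reduced : ∀ {α} (c : ℚ) → α ∈ Φ → (c · α) ∈ Φ → (c ≡ 1ℚ) ⊎ (c ≡ - 1ℚ)
    Φ-irred  : ∀ (f : V r → Bool) →
                 (∀ {α β} → α ∈ Φ → β ∈ Φ → f α ≢ f β → ⟨ α ∣ β ⟩ ≡ 0ℚ) →
                 ∀ {α β} → α ∈ Φ → β ∈ Φ → f α ≡ f β
    simple   : Fin r → V r
    simple∈Φ : ∀ i → simple i ∈ Φ
    simple-indep : ∀ (c : Fin r → ℚ) → ΣV r (λ i → c i · simple i) ≡ 𝟘 → ∀ i → c i ≡ 0ℚ
    simple-base  : ∀ {β} → β ∈ Φ → ∃ λ (c : Fin r → ℕ) →
                     (β ≡ ΣV r (λ i → ℕ→ℚ (c i) · simple i))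
                     ⊎ (β ≡ (- 1ℚ) · ΣV r (λ i → ℕ→ℚ (c i) · simple i))

module _ {r : ℕ} (R : RootSystem r) where
  open RootSystem R

  Pos : V r → Set
  Pos β = β ∈ Φ × ∃ λ (c : Fin r → ℕ) → β ≡ ΣV r (λ i → ℕ→ℚ (c i) · simple i)

  sAff : V r → ℤ → V r → V r
  sAff α k v = v ⊕ ((ℤ→ℚ k - ⟨ v ∣ α ⟩) · coroot α)

  act : List (V r × ℤ) → V r → V r
  act []             v = v
  act ((β , k) ∷ w) v = sAff β k (act w v)

  InW : (V r → V r) → Set
  InW f = ∃ λ (w : List (V r × ℤ)) → All (λ p → Pos (proj₁ p)) w × (∀ v → f v ≡ act w v)

  InA₊ : V r → Set
  InA₊ x = ∀ {α} → Pos α → (0ℚ < ⟨ x ∣ α ⟩) × (⟨ x ∣ α ⟩ < 1ℚ)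

  InAlcove : (V r → V r) → V r → Set
  InAlcove w u = ∃ λ x → InA₊ x × u ≡ w x

  t : V r → V r → V r
  t μ v = v ⊕ μ

  InCorootLattice : V r → Set
  InCorootLattice μ = ∃ λ (c : List (ℤ × V r)) → All (λ p → proj₂ p ∈ Φ) c
                 × μ ≡ Data.List.foldr (λ p acc → (ℤ→ℚ (proj₁ p) · coroot (proj₂ p)) ⊕ acc) 𝟘 c

  _⪯_ : V r → V r → Set
  μ ⪯ λ' = ∃ λ (c : Fin r → ℕ) → λ' ⊖ μ ≡ ΣV r (λ i → ℕ→ℚ (c i) · coroot (simple i))

  -- affine order: Chain y x holds iff there are y = y₀, y₁, …, yₙ = x in W
  -- and affine reflections s_{βᵢ,kᵢ} (βᵢ ∈ Φ⁺) with s_{βᵢ,kᵢ} yᵢ = yᵢ₋₁ and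
  -- (u|βᵢ) > kᵢ for all u ∈ A_{yᵢ}.  (Maps are compared pointwise.)
  data _≤a_ (y : V r → V r) : (V r → V r) → Set where
    done : ∀ {x} → InW x → (∀ v → y v ≡ x v) → y ≤a x
    step : ∀ {z x} (β : V r) (k : ℤ) → y ≤a z → Pos β → InW x →
           (∀ v → z v ≡ sAff β k (x v)) →
           (∀ u → InAlcove x u → ℤ→ℚ k < ⟨ u ∣ β ⟩) →
           y ≤a x

-- (⇐) It suffices to raise μ by one simple coroot α^∨: with λ = μ + α^∨ and L = (λ | α) ∈ ℤ we have
-- t_μ = s_{α,L-1} s_{α,L} t_λ, where A_{t_λ} lies above H_{α,L} and s_{α,L} A_{t_λ} above H_{α,L-1}.
-- (⇒) Fix p ∈ A₊. A step y = s_{β,k} x with A_x above H_{β,k} gives x p - y p = ((x p | β) - k) β^∨,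
-- a nonnegative multiple of β^∨, and β^∨ is an ℕ-combination of simple coroots (by descent on the
-- height of β through simple reflections). Hence λ - μ = t_λ p - t_μ p has nonnegative rational
-- coordinates in the basis of simple coroots; since λ - μ lies in the coroot lattice these
-- coordinates are integers, so μ ⪯ λ.

module Submission where

open import Defs
open import Data.Nat as ℕ using (ℕ; zero; suc)
import Data.Nat.Properties as ℕP
import Algebra.Properties.CommutativeSemigroup ℕP.+-commutativeSemigroup as ℕ+
open import Data.Nat.Induction using (<-rec)
import Data.Nat.Coprimality as Coprime
open import Data.Integer as ℤ using (ℤ; -[1+_]; +[1+_])
import Data.Integer.Properties as ℤP
open import Data.Rational as ℚ using (ℚ; mkℚ; 0ℚ; 1ℚ; _+_; _*_; _-_; -_; _<_; _≤_; _/_; ↥_)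
import Data.Rational.Properties as ℚP
open import Data.Rational.Solver using (module +-*-Solver)
open +-*-Solver using (solve; _:+_; _:*_; _:-_; :-_; _:=_; con)
open import Data.Fin as Fin using (Fin; zero; suc; toℕ)
import Data.Fin.Properties as FinP
open import Data.Vec using ([]; _∷_; lookup)
import Data.Vec.Properties as VecP
open import Data.List using (List; []; _∷_; _++_; foldr)
open import Data.List.Membership.Propositional using (_∈_)
open import Data.List.Relation.Unary.All using (All; []; _∷_)
import Data.List.Relation.Unary.All.Properties as AllP
open import Data.List.Relation.Unary.Any using (here; there)
open import Data.Product using (Σ; ∃; _×_; _,_; proj₁; proj₂; map₂)
open import Data.Sum using (_⊎_; inj₁; inj₂; [_,_]′)
open import Data.Empty using (⊥-elim)
open import Function using (_∘_)
open import Relation.Nullary using (¬_)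
open import Relation.Binary.Definitions using (tri<; tri≈; tri>)
open import Relation.Binary.PropositionalEquality

ℤ→ℚ≡mkℚ : ∀ z → ℤ→ℚ z ≡ mkℚ z 0 (Coprime.sym (Coprime.1-coprimeTo ℤ.∣ z ∣))
ℤ→ℚ≡mkℚ z = ℚP.↥p/↧p≡p (mkℚ z 0 (Coprime.sym (Coprime.1-coprimeTo ℤ.∣ z ∣)))

ℤ→ℚ-+ : ∀ a b → ℤ→ℚ (a ℤ.+ b) ≡ ℤ→ℚ a + ℤ→ℚ b
ℤ→ℚ-+ a b rewrite ℤ→ℚ≡mkℚ a | ℤ→ℚ≡mkℚ b =
  cong (_/ 1) (cong₂ ℤ._+_ (sym (ℤP.*-identityʳ a)) (sym (ℤP.*-identityʳ b)))

ℤ→ℚ-* : ∀ a b → ℤ→ℚ (a ℤ.* b) ≡ ℤ→ℚ a * ℤ→ℚ b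
ℤ→ℚ-* a b rewrite ℤ→ℚ≡mkℚ a | ℤ→ℚ≡mkℚ b = refl

ℤ→ℚ-neg : ∀ a → ℤ→ℚ (ℤ.- a) ≡ - ℤ→ℚ a
ℤ→ℚ-neg (ℤ.+ zero) = refl
ℤ→ℚ-neg +[1+ n ]   = refl
ℤ→ℚ-neg -[1+ n ]   = trans (ℤ→ℚ≡mkℚ +[1+ n ]) (cong -_ (sym (ℤ→ℚ≡mkℚ -[1+ n ])))

ℤ→ℚ-nonNeg⇒ℕ : ∀ z → 0ℚ ≤ ℤ→ℚ z → Σ ℕ λ m → z ≡ ℤ.+ m
ℤ→ℚ-nonNeg⇒ℕ (ℤ.+ m) _ = m , refl
ℤ→ℚ-nonNeg⇒ℕ -[1+ n ] h with ℚP.drop-*≤* (subst (0ℚ ≤_) (ℤ→ℚ≡mkℚ -[1+ n ]) h)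
... | ()

ℤ→ℚ-pos⇒ℕ⁺ : ∀ z → 0ℚ < ℤ→ℚ z → Σ ℕ λ n → z ≡ ℤ.+ suc n
ℤ→ℚ-pos⇒ℕ⁺ z 0<z with ℤ→ℚ-nonNeg⇒ℕ z (ℚP.<⇒≤ 0<z)
... | zero  , refl = ⊥-elim (ℚP.<-irrefl refl 0<z)
... | suc n , refl = n , refl

ℕ→ℚ-+ : ∀ a b → ℕ→ℚ (a ℕ.+ b) ≡ ℕ→ℚ a + ℕ→ℚ b
ℕ→ℚ-+ a b = ℤ→ℚ-+ (ℤ.+ a) (ℤ.+ b)

ℕ→ℚ-* : ∀ a b → ℕ→ℚ (a ℕ.* b) ≡ ℕ→ℚ a * ℕ→ℚ b
ℕ→ℚ-* a b = trans (cong ℤ→ℚ (ℤP.pos-* a b)) (ℤ→ℚ-* (ℤ.+ a) (ℤ.+ b))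

ℕ→ℚ-injective : ∀ {a b} → ℕ→ℚ a ≡ ℕ→ℚ b → a ≡ b
ℕ→ℚ-injective {a} {b} e = ℤP.+-injective (begin
  ℤ.+ a            ≡⟨ cong ↥_ (ℤ→ℚ≡mkℚ (ℤ.+ a)) ⟨
  ↥ ℕ→ℚ a          ≡⟨ cong ↥_ e ⟩
  ↥ ℕ→ℚ b          ≡⟨ cong ↥_ (ℤ→ℚ≡mkℚ (ℤ.+ b)) ⟩
  ℤ.+ b            ∎)
  where open ≡-Reasoning

ℕ→ℚ≡-ℕ→ℚ⇒≡0 : ∀ a b → ℕ→ℚ a ≡ (- 1ℚ) * ℕ→ℚ b → a ≡ 0
ℕ→ℚ≡-ℕ→ℚ⇒≡0 a b eq = ℕP.m+n≡0⇒m≡0 a (ℕ→ℚ-injective (begin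
  ℕ→ℚ (a ℕ.+ b)                    ≡⟨ ℕ→ℚ-+ a b ⟩
  ℕ→ℚ a + ℕ→ℚ b                    ≡⟨ cong (_+ ℕ→ℚ b) eq ⟩
  (- 1ℚ) * ℕ→ℚ b + ℕ→ℚ b           ≡⟨ solve 1 (λ y → (:- con 1ℚ) :* y :+ y := con 0ℚ) refl (ℕ→ℚ b) ⟩
  0ℚ                               ∎))
  where open ≡-Reasoning

ℕ→ℚ-mono-< : ∀ {a b} → a ℕ.< b → ℕ→ℚ a < ℕ→ℚ b
ℕ→ℚ-mono-< {a} {b} lt rewrite ℤ→ℚ≡mkℚ (ℤ.+ a) | ℤ→ℚ≡mkℚ (ℤ.+ b) =
  ℚ.*<* (subst₂ ℤ._<_ (sym (ℤP.*-identityʳ (ℤ.+ a))) (sym (ℤP.*-identityʳ (ℤ.+ b))) (ℤ.+<+ lt))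

ℕ→ℚ-nonNeg : ∀ n → 0ℚ ≤ ℕ→ℚ n
ℕ→ℚ-nonNeg n = subst (0ℚ ≤_) (sym (ℤ→ℚ≡mkℚ (ℤ.+ n))) (ℚP.nonNegative⁻¹ _)

ℕ→ℚ-pos : ∀ n → 0ℚ < ℕ→ℚ (suc n)
ℕ→ℚ-pos n = subst (0ℚ <_) (sym (ℤ→ℚ≡mkℚ (ℤ.+ suc n))) (ℚP.positive⁻¹ _)

inv-inverseʳ : ∀ q → 0ℚ < q → q * inv q ≡ 1ℚ
inv-inverseʳ (mkℚ +[1+ n ] d c) _ = ℚP.*-inverseʳ (mkℚ +[1+ n ] d c)
inv-inverseʳ (mkℚ (ℤ.+ 0) d c) h with ℚP.drop-*<* h
... | ℤ.+<+ ()
inv-inverseʳ (mkℚ -[1+ n ] d c) h with ℚP.drop-*<* h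
... | ()

inv-pos : ∀ q → 0ℚ < q → 0ℚ < inv q
inv-pos (mkℚ +[1+ n ] d c) _ = ℚP.positive⁻¹ _ {{ℚP.1/pos⇒pos (mkℚ +[1+ n ] d c)}}
inv-pos (mkℚ (ℤ.+ 0) d c) h with ℚP.drop-*<* h
... | ℤ.+<+ ()
inv-pos (mkℚ -[1+ n ] d c) h with ℚP.drop-*<* h
... | ()

*-cancelʳ-pos : ∀ {a b c} → 0ℚ < c → a * c ≡ b * c → a ≡ b
*-cancelʳ-pos {a} {b} {c} 0<c eq = begin
  a                   ≡⟨ ℚP.*-identityʳ a ⟨
  a * 1ℚ              ≡⟨ cong (a *_) (inv-inverseʳ c 0<c) ⟨
  a * (c * inv c)     ≡⟨ ℚP.*-assoc a c (inv c) ⟨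
  a * c * inv c       ≡⟨ cong (_* inv c) eq ⟩
  b * c * inv c       ≡⟨ ℚP.*-assoc b c (inv c) ⟩
  b * (c * inv c)     ≡⟨ cong (b *_) (inv-inverseʳ c 0<c) ⟩
  b * 1ℚ              ≡⟨ ℚP.*-identityʳ b ⟩
  b                   ∎
  where open ≡-Reasoning

pos*pos : ∀ {a b} → 0ℚ < a → 0ℚ < b → 0ℚ < a * b
pos*pos {a} {b} ha hb =
  ℚP.positive⁻¹ _ {{ℚP.pos*pos⇒pos a {{ℚ.positive ha}} b {{ℚ.positive hb}}}}

nonNeg*nonNeg : ∀ {a b} → 0ℚ ≤ a → 0ℚ ≤ b → 0ℚ ≤ a * b
nonNeg*nonNeg {a} {b} ha hb =
  ℚP.nonNegative⁻¹ _ {{ℚP.nonNeg*nonNeg⇒nonNeg a {{ℚ.nonNegative ha}} b {{ℚ.nonNegative hb}}}}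

0<2 : 0ℚ < 2ℚ
0<2 = ℚP.positive⁻¹ _

0≰-1 : ¬ (0ℚ ≤ - 1ℚ)
0≰-1 h with ℚP.drop-*≤* h
... | ()

<⇒0≤- : ∀ {a b} → a < b → 0ℚ ≤ b - a
<⇒0≤- {a} {b} h = subst (_≤ b - a) (ℚP.+-inverseʳ a) (ℚP.+-mono-≤ (ℚP.<⇒≤ h) (ℚP.≤-refl { - a}))

⊕-comm : ∀ {n} (u v : V n) → u ⊕ v ≡ v ⊕ u
⊕-comm []      []      = refl
⊕-comm (x ∷ u) (y ∷ v) = cong₂ _∷_ (ℚP.+-comm x y) (⊕-comm u v)

⊕-assoc : ∀ {n} (u v w : V n) → (u ⊕ v) ⊕ w ≡ u ⊕ (v ⊕ w)
⊕-assoc []      []      []      = refl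
⊕-assoc (x ∷ u) (y ∷ v) (z ∷ w) = cong₂ _∷_ (ℚP.+-assoc x y z) (⊕-assoc u v w)

⊕-identityˡ : ∀ {n} (u : V n) → 𝟘 ⊕ u ≡ u
⊕-identityˡ []      = refl
⊕-identityˡ (x ∷ u) = cong₂ _∷_ (ℚP.+-identityˡ x) (⊕-identityˡ u)

⊕-identityʳ : ∀ {n} (u : V n) → u ⊕ 𝟘 ≡ u
⊕-identityʳ []      = refl
⊕-identityʳ (x ∷ u) = cong₂ _∷_ (ℚP.+-identityʳ x) (⊕-identityʳ u)

⊕-inverseʳ : ∀ {n} (u : V n) → u ⊕ ((- 1ℚ) · u) ≡ 𝟘
⊕-inverseʳ []      = refl
⊕-inverseʳ (x ∷ u) = cong₂ _∷_ (solve 1 (λ x → x :+ (:- con 1ℚ) :* x := con 0ℚ) refl x) (⊕-inverseʳ u)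

⊕-interchange : ∀ {n} (a b c d : V n) → (a ⊕ b) ⊕ (c ⊕ d) ≡ (a ⊕ c) ⊕ (b ⊕ d)
⊕-interchange []      []      []      []      = refl
⊕-interchange (x ∷ a) (y ∷ b) (z ∷ c) (w ∷ d) =
  cong₂ _∷_ (solve 4 (λ x y z w → (x :+ y) :+ (z :+ w) := (x :+ z) :+ (y :+ w)) refl x y z w)
            (⊕-interchange a b c d)

·-distribˡ-⊕ : ∀ {n} c (u v : V n) → c · (u ⊕ v) ≡ (c · u) ⊕ (c · v)
·-distribˡ-⊕ c []      []      = refl
·-distribˡ-⊕ c (x ∷ u) (y ∷ v) = cong₂ _∷_ (ℚP.*-distribˡ-+ c x y) (·-distribˡ-⊕ c u v)

·-distribʳ-+ : ∀ {n} a b (u : V n) → (a + b) · u ≡ (a · u) ⊕ (b · u)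
·-distribʳ-+ a b []      = refl
·-distribʳ-+ a b (x ∷ u) = cong₂ _∷_ (ℚP.*-distribʳ-+ x a b) (·-distribʳ-+ a b u)

·-assoc : ∀ {n} a b (u : V n) → (a * b) · u ≡ a · (b · u)
·-assoc a b []      = refl
·-assoc a b (x ∷ u) = cong₂ _∷_ (ℚP.*-assoc a b x) (·-assoc a b u)

·-identityˡ : ∀ {n} (u : V n) → 1ℚ · u ≡ u
·-identityˡ []      = refl
·-identityˡ (x ∷ u) = cong₂ _∷_ (ℚP.*-identityˡ x) (·-identityˡ u)

·-zeroˡ : ∀ {n} (u : V n) → 0ℚ · u ≡ 𝟘
·-zeroˡ []      = refl
·-zeroˡ (x ∷ u) = cong₂ _∷_ (ℚP.*-zeroˡ x) (·-zeroˡ u)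

·-zeroʳ : ∀ {n} c → c · 𝟘 {n} ≡ 𝟘
·-zeroʳ {zero}  c = refl
·-zeroʳ {suc n} c = cong₂ _∷_ (ℚP.*-zeroʳ c) (·-zeroʳ {n} c)

⊖≡⊕-neg : ∀ {n} (u v : V n) → u ⊖ v ≡ u ⊕ ((- 1ℚ) · v)
⊖≡⊕-neg []      []      = refl
⊖≡⊕-neg (x ∷ u) (y ∷ v) =
  cong₂ _∷_ (solve 2 (λ x y → x :- y := x :+ (:- con 1ℚ) :* y) refl x y) (⊖≡⊕-neg u v)

⊖-self : ∀ {n} (u : V n) → u ⊖ u ≡ 𝟘
⊖-self []      = refl
⊖-self (x ∷ u) = cong₂ _∷_ (ℚP.+-inverseʳ x) (⊖-self u)

⊕-⊖-cancel : ∀ {n} (u v : V n) → u ⊕ (v ⊖ u) ≡ v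
⊕-⊖-cancel []      []      = refl
⊕-⊖-cancel (x ∷ u) (y ∷ v) =
  cong₂ _∷_ (solve 2 (λ x y → x :+ (y :- x) := y) refl x y) (⊕-⊖-cancel u v)

⊕-⊖-⊕-cancelˡ : ∀ {n} (p a b : V n) → (p ⊕ a) ⊖ (p ⊕ b) ≡ a ⊖ b
⊕-⊖-⊕-cancelˡ []      []      []      = refl
⊕-⊖-⊕-cancelˡ (x ∷ p) (y ∷ a) (z ∷ b) =
  cong₂ _∷_ (solve 3 (λ x y z → (x :+ y) :- (x :+ z) := y :- z) refl x y z) (⊕-⊖-⊕-cancelˡ p a b)

ΣQ-cong : ∀ n {f g : Fin n → ℚ} → (∀ i → f i ≡ g i) → ΣQ n f ≡ ΣQ n g
ΣQ-cong zero    h = refl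
ΣQ-cong (suc n) h = cong₂ _+_ (h zero) (ΣQ-cong n (λ i → h (suc i)))

ΣQ-zero : ∀ n → ΣQ n (λ _ → 0ℚ) ≡ 0ℚ
ΣQ-zero zero    = refl
ΣQ-zero (suc n) = trans (ℚP.+-identityˡ _) (ΣQ-zero n)

ΣQ-+ : ∀ n (f g : Fin n → ℚ) → ΣQ n (λ i → f i + g i) ≡ ΣQ n f + ΣQ n g
ΣQ-+ zero    f g = refl
ΣQ-+ (suc n) f g =
  trans (cong (f zero + g zero +_) (ΣQ-+ n (λ i → f (suc i)) (λ i → g (suc i))))
        (solve 4 (λ a b c d → (a :+ b) :+ (c :+ d) := (a :+ c) :+ (b :+ d)) refl (f zero) (g zero) _ _)

ΣQ-* : ∀ n c (f : Fin n → ℚ) → ΣQ n (λ i → c * f i) ≡ c * ΣQ n f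
ΣQ-* zero    c f = sym (ℚP.*-zeroʳ c)
ΣQ-* (suc n) c f =
  trans (cong (c * f zero +_) (ΣQ-* n c (λ i → f (suc i)))) (sym (ℚP.*-distribˡ-+ c _ _))

ΣQ-swap : ∀ n m (f : Fin n → Fin m → ℚ) →
          ΣQ n (λ i → ΣQ m (λ j → f i j)) ≡ ΣQ m (λ j → ΣQ n (λ i → f i j))
ΣQ-swap zero    m f = sym (ΣQ-zero m)
ΣQ-swap (suc n) m f =
  trans (cong (ΣQ m (f zero) +_) (ΣQ-swap n m (λ i → f (suc i))))
        (sym (ΣQ-+ m (f zero) (λ j → ΣQ n (λ i → f (suc i) j))))

ΣQ-nonPos : ∀ n (f : Fin n → ℚ) → (∀ i → f i ≤ 0ℚ) → ΣQ n f ≤ 0ℚ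
ΣQ-nonPos zero    f h = ℚP.≤-refl
ΣQ-nonPos (suc n) f h = ℚP.+-mono-≤ (h zero) (ΣQ-nonPos n (λ i → f (suc i)) (λ i → h (suc i)))

ΣQ-single : ∀ n k (f : Fin n → ℚ) → (∀ i → i ≢ k → f i ≡ 0ℚ) → ΣQ n f ≡ f k
ΣQ-single (suc n) zero f h =
  trans (cong (f zero +_) (trans (ΣQ-cong n (λ i → h (suc i) (λ ()))) (ΣQ-zero n))) (ℚP.+-identityʳ (f zero))
ΣQ-single (suc n) (suc k) f h =
  trans (cong (_+ ΣQ n (λ i → f (suc i))) (h zero (λ ())))
        (trans (ℚP.+-identityˡ _)
               (ΣQ-single n k (λ i → f (suc i)) (λ i i≢k → h (suc i) (i≢k ∘ FinP.suc-injective))))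

ΣV-cong : ∀ {r} n {f g : Fin n → V r} → (∀ i → f i ≡ g i) → ΣV n f ≡ ΣV n g
ΣV-cong zero    h = refl
ΣV-cong (suc n) h = cong₂ _⊕_ (h zero) (ΣV-cong n (λ i → h (suc i)))

ΣV-zero : ∀ {r} n (v : Fin n → V r) → ΣV n (λ i → 0ℚ · v i) ≡ 𝟘
ΣV-zero zero    v = refl
ΣV-zero (suc n) v = trans (cong₂ _⊕_ (·-zeroˡ (v zero)) (ΣV-zero n (λ i → v (suc i)))) (⊕-identityʳ 𝟘)

ΣV-+ : ∀ {r} n (a b : Fin n → ℚ) (v : Fin n → V r) →
       ΣV n (λ i → (a i + b i) · v i) ≡ ΣV n (λ i → a i · v i) ⊕ ΣV n (λ i → b i · v i)
ΣV-+ zero    a b v = sym (⊕-identityʳ 𝟘)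
ΣV-+ (suc n) a b v =
  trans (cong₂ _⊕_ (·-distribʳ-+ (a zero) (b zero) (v zero))
                   (ΣV-+ n (λ i → a (suc i)) (λ i → b (suc i)) (λ i → v (suc i))))
        (⊕-interchange _ _ _ _)

ΣV-* : ∀ {r} n c (a : Fin n → ℚ) (v : Fin n → V r) →
       ΣV n (λ i → (c * a i) · v i) ≡ c · ΣV n (λ i → a i · v i)
ΣV-* zero    c a v = sym (·-zeroʳ c)
ΣV-* (suc n) c a v =
  trans (cong₂ _⊕_ (·-assoc c (a zero) (v zero)) (ΣV-* n c (λ i → a (suc i)) (λ i → v (suc i))))
        (sym (·-distribˡ-⊕ c _ _))

δ : ∀ {n} → Fin n → Fin n → ℕ
δ zero    zero    = 1
δ zero    (suc j) = 0
δ (suc i) zero    = 0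
δ (suc i) (suc j) = δ i j

δ-diag : ∀ {n} (i : Fin n) → δ i i ≡ 1
δ-diag zero    = refl
δ-diag (suc i) = δ-diag i

δ-off : ∀ {n} (i j : Fin n) → j ≢ i → δ i j ≡ 0
δ-off zero    zero    h = ⊥-elim (h refl)
δ-off zero    (suc j) h = refl
δ-off (suc i) zero    h = refl
δ-off (suc i) (suc j) h = δ-off i j (λ e → h (cong suc e))

ΣV-δ : ∀ {r} n i (v : Fin n → V r) → ΣV n (λ j → ℕ→ℚ (δ i j) · v j) ≡ v i
ΣV-δ (suc n) zero v =
  trans (cong₂ _⊕_ (·-identityˡ (v zero)) (ΣV-zero n (λ j → v (suc j)))) (⊕-identityʳ (v zero))
ΣV-δ (suc n) (suc i) v =
  trans (cong₂ _⊕_ (·-zeroˡ (v zero)) (ΣV-δ n i (λ j → v (suc j)))) (⊕-identityˡ _)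

ΣV-single : ∀ {r} n i (a : Fin n → ℚ) (v : Fin n → V r) → (∀ j → j ≢ i → a j ≡ 0ℚ) →
            ΣV n (λ j → a j · v j) ≡ a i · v i
ΣV-single (suc n) zero a v off =
  trans (cong ((a zero · v zero) ⊕_)
          (trans (ΣV-cong n (λ j → cong (_· v (suc j)) (off (suc j) (λ ())))) (ΣV-zero n (v ∘ suc))))
        (⊕-identityʳ _)
ΣV-single (suc n) (suc i) a v off =
  trans (cong₂ _⊕_ (trans (cong (_· v zero) (off zero (λ ()))) (·-zeroˡ (v zero)))
                   (ΣV-single n i (a ∘ suc) (v ∘ suc) (λ j j≢i → off (suc j) (j≢i ∘ FinP.suc-injective))))
        (⊕-identityˡ _)

ΣN : ∀ n → (Fin n → ℕ) → ℕ
ΣN n = ΣF n ℕ._+_ 0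

ΣN-cong : ∀ n {f g : Fin n → ℕ} → (∀ i → f i ≡ g i) → ΣN n f ≡ ΣN n g
ΣN-cong zero    h = refl
ΣN-cong (suc n) h = cong₂ ℕ._+_ (h zero) (ΣN-cong n (λ i → h (suc i)))

ΣN≡0⇒≡0 : ∀ n (c : Fin n → ℕ) → ΣN n c ≡ 0 → ∀ i → c i ≡ 0
ΣN≡0⇒≡0 (suc n) c h zero    = ℕP.m+n≡0⇒m≡0 (c zero) h
ΣN≡0⇒≡0 (suc n) c h (suc i) = ΣN≡0⇒≡0 n (λ i → c (suc i)) (ℕP.m+n≡0⇒n≡0 (c zero) h) i

≡0⇒ΣN≡0 : ∀ n (c : Fin n → ℕ) → (∀ i → c i ≡ 0) → ΣN n c ≡ 0
≡0⇒ΣN≡0 zero    c h = refl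
≡0⇒ΣN≡0 (suc n) c h = cong₂ ℕ._+_ (h zero) (≡0⇒ΣN≡0 n (λ i → c (suc i)) (λ i → h (suc i)))

ℕ→ℚ-ΣN : ∀ n (c : Fin n → ℕ) → ℕ→ℚ (ΣN n c) ≡ ΣQ n (λ i → ℕ→ℚ (c i))
ℕ→ℚ-ΣN zero    c = refl
ℕ→ℚ-ΣN (suc n) c = trans (ℕ→ℚ-+ (c zero) _) (cong (ℕ→ℚ (c zero) +_) (ℕ→ℚ-ΣN n (λ i → c (suc i))))

ΣN-lower : ∀ n k (e c : Fin n → ℕ) N → (∀ i → i ≢ k → e i ≡ c i) → e k ℕ.+ N ≡ c k →
           ΣN n e ℕ.+ N ≡ ΣN n c
ΣN-lower (suc n) zero e c N off at = begin
  (e zero ℕ.+ S) ℕ.+ N  ≡⟨ ℕ+.xy∙z≈xz∙y (e zero) S N ⟩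
  (e zero ℕ.+ N) ℕ.+ S  ≡⟨ cong₂ ℕ._+_ at (ΣN-cong n (λ i → off (suc i) (λ ()))) ⟩
  ΣN (suc n) c          ∎
  where
  open ≡-Reasoning
  S = ΣN n (λ i → e (suc i))
ΣN-lower (suc n) (suc k) e c N off at = begin
  (e zero ℕ.+ S) ℕ.+ N    ≡⟨ ℕP.+-assoc (e zero) S N ⟩
  e zero ℕ.+ (S ℕ.+ N)    ≡⟨ cong₂ ℕ._+_ (off zero (λ ()))
                               (ΣN-lower n k (λ i → e (suc i)) (λ i → c (suc i)) N
                                  (λ i i≢k → off (suc i) (i≢k ∘ FinP.suc-injective)) at) ⟩
  ΣN (suc n) c            ∎
  where
  open ≡-Reasoning
  S = ΣN n (λ i → e (suc i))

uniform-bound : ∀ {A : Set} (P : A → ℕ → Set) → (∀ {x m n} → m ℕ.≤ n → P x m → P x n) →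
                (xs : List A) → (∀ {x} → x ∈ xs → ∃ (P x)) → ∃ λ H → ∀ {x} → x ∈ xs → P x H
uniform-bound P mono []       bounded = 0 , λ ()
uniform-bound P mono (x ∷ xs) bounded =
  Hₓ ℕ.⊔ H , λ { (here refl) → mono (ℕP.m≤m⊔n Hₓ H) (proj₂ (bounded (here refl)))
               ; (there x∈xs) → mono (ℕP.m≤n⊔m Hₓ H) (bound x∈xs) }
  where
  Hₓ = proj₁ (bounded (here refl))
  H = proj₁ (uniform-bound P mono xs (bounded ∘ there))
  bound = proj₂ (uniform-bound P mono xs (bounded ∘ there))

module _ {r : ℕ} (R : RootSystem r) where
  open RootSystem R

  ⟨∣⟩-sym : ∀ u v → ⟨ u ∣ v ⟩ ≡ ⟨ v ∣ u ⟩
  ⟨∣⟩-sym u v = trans (ΣQ-cong r (λ i → ΣQ-cong r (λ j → swap i j)))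
                      (sym (ΣQ-swap r r (λ i j → lookup v i * (G i j * lookup u j))))
    where
    swap : ∀ i j → lookup u i * (G i j * lookup v j) ≡ lookup v j * (G j i * lookup u i)
    swap i j rewrite G-sym j i =
      solve 3 (λ a g b → a :* (g :* b) := b :* (g :* a)) refl (lookup u i) (G i j) (lookup v j)

  ⟨⊕∣⟩ : ∀ u w v → ⟨ u ⊕ w ∣ v ⟩ ≡ ⟨ u ∣ v ⟩ + ⟨ w ∣ v ⟩
  ⟨⊕∣⟩ u w v = trans (ΣQ-cong r (λ i → trans (ΣQ-cong r (distrib i)) (ΣQ-+ r _ _))) (ΣQ-+ r _ _)
    where
    distrib : ∀ i j → lookup (u ⊕ w) i * (G i j * lookup v j)
                    ≡ lookup u i * (G i j * lookup v j) + lookup w i * (G i j * lookup v j)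
    distrib i j rewrite VecP.lookup-zipWith _+_ i u w = ℚP.*-distribʳ-+ _ (lookup u i) (lookup w i)

  ⟨·∣⟩ : ∀ c u v → ⟨ c · u ∣ v ⟩ ≡ c * ⟨ u ∣ v ⟩
  ⟨·∣⟩ c u v = trans (ΣQ-cong r (λ i → trans (ΣQ-cong r (assoc i)) (ΣQ-* r c _))) (ΣQ-* r c _)
    where
    assoc : ∀ i j → lookup (c · u) i * (G i j * lookup v j) ≡ c * (lookup u i * (G i j * lookup v j))
    assoc i j rewrite VecP.lookup-map i (c *_) u = ℚP.*-assoc c (lookup u i) _

  ⟨∣·⟩ : ∀ v c u → ⟨ v ∣ c · u ⟩ ≡ c * ⟨ v ∣ u ⟩
  ⟨∣·⟩ v c u = trans (⟨∣⟩-sym v (c · u)) (trans (⟨·∣⟩ c u v) (cong (c *_) (⟨∣⟩-sym u v)))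

  ⟨𝟘∣⟩ : ∀ v → ⟨ 𝟘 ∣ v ⟩ ≡ 0ℚ
  ⟨𝟘∣⟩ v = trans (cong ⟨_∣ v ⟩ (sym (·-zeroʳ {r} 0ℚ))) (trans (⟨·∣⟩ 0ℚ 𝟘 v) (ℚP.*-zeroˡ ⟨ 𝟘 ∣ v ⟩))

  ⟨ΣV∣⟩ : ∀ n (f : Fin n → V r) v → ⟨ ΣV n f ∣ v ⟩ ≡ ΣQ n (λ i → ⟨ f i ∣ v ⟩)
  ⟨ΣV∣⟩ zero    f v = ⟨𝟘∣⟩ v
  ⟨ΣV∣⟩ (suc n) f v = trans (⟨⊕∣⟩ (f zero) _ v) (cong (⟨ f zero ∣ v ⟩ +_) (⟨ΣV∣⟩ n (λ i → f (suc i)) v))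

  ⟨⊖∣⟩ : ∀ u w v → ⟨ u ⊖ w ∣ v ⟩ ≡ ⟨ u ∣ v ⟩ - ⟨ w ∣ v ⟩
  ⟨⊖∣⟩ u w v = begin
    ⟨ u ⊖ w ∣ v ⟩                    ≡⟨ cong ⟨_∣ v ⟩ (⊖≡⊕-neg u w) ⟩
    ⟨ u ⊕ ((- 1ℚ) · w) ∣ v ⟩         ≡⟨ ⟨⊕∣⟩ u _ v ⟩
    ⟨ u ∣ v ⟩ + ⟨ (- 1ℚ) · w ∣ v ⟩   ≡⟨ cong (⟨ u ∣ v ⟩ +_) (⟨·∣⟩ (- 1ℚ) w v) ⟩
    ⟨ u ∣ v ⟩ + (- 1ℚ) * ⟨ w ∣ v ⟩   ≡⟨ solve 2 (λ a b → a :+ (:- con 1ℚ) :* b := a :- b) refl ⟨ u ∣ v ⟩ ⟨ w ∣ v ⟩ ⟩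
    ⟨ u ∣ v ⟩ - ⟨ w ∣ v ⟩            ∎
    where open ≡-Reasoning

  ⟨∣⊖⟩ : ∀ v u w → ⟨ v ∣ u ⊖ w ⟩ ≡ ⟨ v ∣ u ⟩ - ⟨ v ∣ w ⟩
  ⟨∣⊖⟩ v u w = trans (⟨∣⟩-sym v (u ⊖ w)) (trans (⟨⊖∣⟩ u w v) (cong₂ _-_ (⟨∣⟩-sym u v) (⟨∣⟩-sym w v)))

  root-norm-pos : ∀ {α} → α ∈ Φ → 0ℚ < ⟨ α ∣ α ⟩
  root-norm-pos {α} α∈Φ = G-posdef α (λ α≡𝟘 → Φ-nonzero (subst (_∈ Φ) α≡𝟘 α∈Φ))

  ⟨coroot∣root⟩≡2 : ∀ {α} → α ∈ Φ → ⟨ coroot α ∣ α ⟩ ≡ 2ℚ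
  ⟨coroot∣root⟩≡2 {α} α∈Φ = begin
    ⟨ coroot α ∣ α ⟩      ≡⟨ ⟨·∣⟩ (2ℚ * inv a) α α ⟩
    (2ℚ * inv a) * a      ≡⟨ solve 2 (λ i a → (con 2ℚ :* i) :* a := con 2ℚ :* (a :* i)) refl (inv a) a ⟩
    2ℚ * (a * inv a)      ≡⟨ cong (2ℚ *_) (inv-inverseʳ a (root-norm-pos α∈Φ)) ⟩
    2ℚ                    ∎
    where
    open ≡-Reasoning
    a = ⟨ α ∣ α ⟩

  -Φ⊆Φ : ∀ {α} → α ∈ Φ → (- 1ℚ) · α ∈ Φ
  -Φ⊆Φ {α} α∈Φ = subst (_∈ Φ) (reflect-self α) (Φ-refl α∈Φ α∈Φ)
    where
    a*inv-a≡1 : ⟨ α ∣ α ⟩ * inv ⟨ α ∣ α ⟩ ≡ 1ℚ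
    a*inv-a≡1 = inv-inverseʳ ⟨ α ∣ α ⟩ (root-norm-pos α∈Φ)
    reflect-self : ∀ {n} (x : V n) → x ⊖ (⟨ α ∣ α ⟩ · ((2ℚ * inv ⟨ α ∣ α ⟩) · x)) ≡ (- 1ℚ) · x
    reflect-self []      = refl
    reflect-self (y ∷ x) = cong₂ _∷_ (begin
      y - a * ((2ℚ * i) * y)   ≡⟨ solve 3 (λ a i y → y :- a :* ((con 2ℚ :* i) :* y)
                                                      := y :- con 2ℚ :* (a :* i) :* y) refl a i y ⟩
      y - 2ℚ * (a * i) * y     ≡⟨ cong (λ s → y - 2ℚ * s * y) a*inv-a≡1 ⟩
      y - 2ℚ * 1ℚ * y          ≡⟨ solve 1 (λ y → y :- con 2ℚ :* con 1ℚ :* y := (:- con 1ℚ) :* y) refl y ⟩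
      (- 1ℚ) * y               ∎) (reflect-self x)
      where
      open ≡-Reasoning
      a = ⟨ α ∣ α ⟩
      i = inv ⟨ α ∣ α ⟩

  coroot-neg : ∀ β → coroot ((- 1ℚ) · β) ≡ (- 1ℚ) · coroot β
  coroot-neg β = begin
    (2ℚ * inv ⟨ -β ∣ -β ⟩) · -β     ≡⟨ cong (λ a → (2ℚ * inv a) · -β) norm ⟩
    c · -β                           ≡⟨ ·-assoc c (- 1ℚ) β ⟨
    (c * - 1ℚ) · β                   ≡⟨ cong (_· β) (ℚP.*-comm c (- 1ℚ)) ⟩
    (- 1ℚ * c) · β                   ≡⟨ ·-assoc (- 1ℚ) c β ⟩
    (- 1ℚ) · coroot β                ∎
    where
    open ≡-Reasoning
    -β = (- 1ℚ) · β
    c = 2ℚ * inv ⟨ β ∣ β ⟩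
    norm : ⟨ -β ∣ -β ⟩ ≡ ⟨ β ∣ β ⟩
    norm = trans (⟨·∣⟩ (- 1ℚ) β -β) (trans (cong ((- 1ℚ) *_) (⟨∣·⟩ β (- 1ℚ) β))
             (solve 1 (λ x → (:- con 1ℚ) :* ((:- con 1ℚ) :* x) := x) refl ⟨ β ∣ β ⟩))

  ⟨sAff∣root⟩ : ∀ {β} → β ∈ Φ → ∀ k v → ⟨ sAff R β k v ∣ β ⟩ ≡ (ℤ→ℚ k + ℤ→ℚ k) - ⟨ v ∣ β ⟩
  ⟨sAff∣root⟩ {β} β∈Φ k v = begin
    ⟨ v ⊕ ((K - x) · coroot β) ∣ β ⟩       ≡⟨ ⟨⊕∣⟩ v _ β ⟩
    x + ⟨ (K - x) · coroot β ∣ β ⟩         ≡⟨ cong (x +_) (⟨·∣⟩ (K - x) (coroot β) β) ⟩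
    x + (K - x) * ⟨ coroot β ∣ β ⟩         ≡⟨ cong (λ s → x + (K - x) * s) (⟨coroot∣root⟩≡2 β∈Φ) ⟩
    x + (K - x) * 2ℚ                       ≡⟨ solve 2 (λ x k → x :+ (k :- x) :* con 2ℚ := (k :+ k) :- x) refl x K ⟩
    (K + K) - x                            ∎
    where
    open ≡-Reasoning
    K = ℤ→ℚ k
    x = ⟨ v ∣ β ⟩

  sAff∘sAff : ∀ {β} → β ∈ Φ → ∀ k l v → sAff R β k (sAff R β l v) ≡ v ⊕ ((ℤ→ℚ k - ℤ→ℚ l) · coroot β)
  sAff∘sAff {β} β∈Φ k l v = begin
    (v ⊕ ((L - x) · b)) ⊕ ((K - ⟨ sAff R β l v ∣ β ⟩) · b)
      ≡⟨ cong (λ s → (v ⊕ ((L - x) · b)) ⊕ ((K - s) · b)) (⟨sAff∣root⟩ β∈Φ l v) ⟩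
    (v ⊕ ((L - x) · b)) ⊕ ((K - ((L + L) - x)) · b)
      ≡⟨ ⊕-assoc v _ _ ⟩
    v ⊕ (((L - x) · b) ⊕ ((K - ((L + L) - x)) · b))
      ≡⟨ cong (v ⊕_) (·-distribʳ-+ (L - x) (K - ((L + L) - x)) b) ⟨
    v ⊕ (((L - x) + (K - ((L + L) - x))) · b)
      ≡⟨ cong (λ s → v ⊕ (s · b)) (solve 3 (λ l x k → (l :- x) :+ (k :- ((l :+ l) :- x)) := k :- l) refl L x K) ⟩
    v ⊕ ((K - L) · b)
      ∎
    where
    open ≡-Reasoning
    K = ℤ→ℚ k
    L = ℤ→ℚ l
    x = ⟨ v ∣ β ⟩
    b = coroot β

  Φ⊆Φ⁺∪-Φ⁺ : ∀ {α} → α ∈ Φ → ∃ λ β → Pos R β × (α ≡ β ⊎ α ≡ (- 1ℚ) · β)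
  Φ⊆Φ⁺∪-Φ⁺ {α} α∈Φ with simple-base α∈Φ
  ... | c , inj₁ α≡ = α , (α∈Φ , c , α≡) , inj₁ refl
  ... | c , inj₂ α≡ = β , (β∈Φ , c , refl) , inj₂ α≡
    where
    β = ΣV r (λ i → ℕ→ℚ (c i) · simple i)
    neg-neg : ∀ {n} (x : V n) → (- 1ℚ) · ((- 1ℚ) · x) ≡ x
    neg-neg x = trans (sym (·-assoc (- 1ℚ) (- 1ℚ) x)) (·-identityˡ x)
    β∈Φ : β ∈ Φ
    β∈Φ = subst (_∈ Φ) (trans (cong ((- 1ℚ) ·_) α≡) (neg-neg β)) (-Φ⊆Φ α∈Φ)

  Σsimple : (Fin r → ℚ) → V r
  Σsimple a = ΣV r (λ j → a j · simple j)

  Σsimple-injective : ∀ a b → Σsimple a ≡ Σsimple b → ∀ j → a j ≡ b j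
  Σsimple-injective a b eq j = begin
    a j                              ≡⟨ solve 2 (λ a b → a := (a :+ (:- con 1ℚ) :* b) :+ b) refl (a j) (b j) ⟩
    (a j + (- 1ℚ) * b j) + b j       ≡⟨ cong (_+ b j) (simple-indep (λ j → a j + (- 1ℚ) * b j) difference≡𝟘 j) ⟩
    0ℚ + b j                         ≡⟨ ℚP.+-identityˡ (b j) ⟩
    b j                              ∎
    where
    open ≡-Reasoning
    difference≡𝟘 : ΣV r (λ j → (a j + (- 1ℚ) * b j) · simple j) ≡ 𝟘
    difference≡𝟘 = begin
      ΣV r (λ j → (a j + (- 1ℚ) * b j) · simple j)      ≡⟨ ΣV-+ r a (λ j → (- 1ℚ) * b j) simple ⟩
      Σsimple a ⊕ ΣV r (λ j → ((- 1ℚ) * b j) · simple j) ≡⟨ cong (Σsimple a ⊕_) (ΣV-* r (- 1ℚ) b simple) ⟩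
      Σsimple a ⊕ ((- 1ℚ) · Σsimple b)                  ≡⟨ cong (λ x → x ⊕ ((- 1ℚ) · Σsimple b)) eq ⟩
      Σsimple b ⊕ ((- 1ℚ) · Σsimple b)                  ≡⟨ ⊕-inverseʳ (Σsimple b) ⟩
      𝟘                                                 ∎

  InW-≗ : ∀ {f g} → InW R f → (∀ v → g v ≡ f v) → InW R g
  InW-≗ (w , w⊆Φ⁺ , f≗w) g≗f = w , w⊆Φ⁺ , λ v → trans (g≗f v) (f≗w v)

  act-++ : ∀ w₁ w₂ v → act R (w₁ ++ w₂) v ≡ act R w₁ (act R w₂ v)
  act-++ []             w₂ v = refl
  act-++ ((β , k) ∷ w₁) w₂ v = cong (sAff R β k) (act-++ w₁ w₂ v)

  InW-∘ : ∀ {f g} → InW R f → InW R g → InW R (λ v → f (g v))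
  InW-∘ {f} {g} (w₁ , w₁⊆Φ⁺ , f≗w₁) (w₂ , w₂⊆Φ⁺ , g≗w₂) =
    w₁ ++ w₂ , AllP.++⁺ w₁⊆Φ⁺ w₂⊆Φ⁺ ,
    λ v → trans (f≗w₁ (g v)) (trans (cong (act R w₁) (g≗w₂ v)) (sym (act-++ w₁ w₂ v)))

  InW-sAff : ∀ {β} k → Pos R β → InW R (sAff R β k)
  InW-sAff {β} k β⁺ = (β , k) ∷ [] , β⁺ ∷ [] , λ v → refl

  InW-t𝟘 : InW R (t R 𝟘)
  InW-t𝟘 = [] , [] , ⊕-identityʳ

  InW-t⊕ : ∀ {a b} → InW R (t R a) → InW R (t R b) → InW R (t R (a ⊕ b))
  InW-t⊕ {a} {b} ta tb = InW-≗ (InW-∘ tb ta) (λ v → sym (⊕-assoc v a b))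

  InW-t-ℤcoroot : ∀ {β} → Pos R β → ∀ z → InW R (t R (ℤ→ℚ z · coroot β))
  InW-t-ℤcoroot {β} β⁺ z = InW-≗ (InW-∘ (InW-sAff z β⁺) (InW-sAff (ℤ.+ 0) β⁺)) λ v →
    trans (cong (λ q → v ⊕ (q · coroot β)) (sym (ℚP.+-identityʳ (ℤ→ℚ z))))
          (sym (sAff∘sAff (proj₁ β⁺) z (ℤ.+ 0) v))

  lattice : List (ℤ × V r) → V r
  lattice = foldr (λ p acc → (ℤ→ℚ (proj₁ p) · coroot (proj₂ p)) ⊕ acc) 𝟘

  InW-t-lattice : ∀ c → All (λ p → proj₂ p ∈ Φ) c → InW R (t R (lattice c))
  InW-t-lattice []            []             = InW-t𝟘
  InW-t-lattice ((z , γ) ∷ c) (γ∈Φ ∷ c⊆Φ) with Φ⊆Φ⁺∪-Φ⁺ γ∈Φ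
  ... | β , β⁺ , inj₁ refl = InW-t⊕ (InW-t-ℤcoroot β⁺ z) (InW-t-lattice c c⊆Φ)
  ... | β , β⁺ , inj₂ refl = InW-t⊕ (InW-≗ (InW-t-ℤcoroot β⁺ (ℤ.- z)) (λ v → cong (v ⊕_) z·-β≡-z·β))
                                   (InW-t-lattice c c⊆Φ)
    where
    open ≡-Reasoning
    z·-β≡-z·β : ℤ→ℚ z · coroot ((- 1ℚ) · β) ≡ ℤ→ℚ (ℤ.- z) · coroot β
    z·-β≡-z·β = begin
      ℤ→ℚ z · coroot ((- 1ℚ) · β)   ≡⟨ cong (ℤ→ℚ z ·_) (coroot-neg β) ⟩
      ℤ→ℚ z · ((- 1ℚ) · coroot β)   ≡⟨ ·-assoc (ℤ→ℚ z) (- 1ℚ) (coroot β) ⟨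
      (ℤ→ℚ z * - 1ℚ) · coroot β     ≡⟨ cong (_· coroot β) (solve 1 (λ x → x :* (:- con 1ℚ) := :- x) refl (ℤ→ℚ z)) ⟩
      (- ℤ→ℚ z) · coroot β          ≡⟨ cong (_· coroot β) (ℤ→ℚ-neg z) ⟨
      ℤ→ℚ (ℤ.- z) · coroot β        ∎

  InW-t : ∀ {μ} → InCorootLattice R μ → InW R (t R μ)
  InW-t (c , c⊆Φ , refl) = InW-t-lattice c c⊆Φ

  ⟨lattice∣root⟩∈ℤ : ∀ {μ} → InCorootLattice R μ → ∀ {α} → α ∈ Φ → ∃ λ z → ⟨ μ ∣ α ⟩ ≡ ℤ→ℚ z
  ⟨lattice∣root⟩∈ℤ ([] , [] , refl) {α} _ = ℤ.+ 0 , ⟨𝟘∣⟩ α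
  ⟨lattice∣root⟩∈ℤ ((z , γ) ∷ c , γ∈Φ ∷ c⊆Φ , refl) {α} α∈Φ
    with Φ-cryst γ∈Φ α∈Φ | ⟨lattice∣root⟩∈ℤ (c , c⊆Φ , refl) α∈Φ
  ... | w , ⟨α∣γ^∨⟩≡w | z′ , ⟨rest∣α⟩≡z′ = z ℤ.* w ℤ.+ z′ , (begin
    ⟨ (ℤ→ℚ z · coroot γ) ⊕ lattice c ∣ α ⟩         ≡⟨ ⟨⊕∣⟩ (ℤ→ℚ z · coroot γ) (lattice c) α ⟩
    ⟨ ℤ→ℚ z · coroot γ ∣ α ⟩ + ⟨ lattice c ∣ α ⟩  ≡⟨ cong₂ _+_ (⟨·∣⟩ (ℤ→ℚ z) (coroot γ) α) ⟨rest∣α⟩≡z′ ⟩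
    ℤ→ℚ z * ⟨ coroot γ ∣ α ⟩ + ℤ→ℚ z′             ≡⟨ cong (λ q → ℤ→ℚ z * q + ℤ→ℚ z′)
                                                         (trans (⟨∣⟩-sym (coroot γ) α) ⟨α∣γ^∨⟩≡w) ⟩
    ℤ→ℚ z * ℤ→ℚ w + ℤ→ℚ z′                        ≡⟨ cong (_+ ℤ→ℚ z′) (ℤ→ℚ-* z w) ⟨
    ℤ→ℚ (z ℤ.* w) + ℤ→ℚ z′                        ≡⟨ ℤ→ℚ-+ (z ℤ.* w) z′ ⟨
    ℤ→ℚ (z ℤ.* w ℤ.+ z′)                          ∎)
    where open ≡-Reasoning

  lattice-+ : ∀ {μ} → InCorootLattice R μ → ∀ z {γ} → γ ∈ Φ →
              InCorootLattice R (μ ⊕ (ℤ→ℚ z · coroot γ))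
  lattice-+ (c , c⊆Φ , refl) z {γ} γ∈Φ = (z , γ) ∷ c , γ∈Φ ∷ c⊆Φ , ⊕-comm (lattice c) _

  ≤a-respʳ : ∀ {y z x} → _≤a_ R y z → (∀ v → z v ≡ x v) → _≤a_ R y x
  ≤a-respʳ (done z∈W y≗z) z≗x = done (InW-≗ z∈W (sym ∘ z≗x)) (λ v → trans (y≗z v) (z≗x v))
  ≤a-respʳ (step β k y≤w β⁺ z∈W w≗sz above) z≗x =
    step β k y≤w β⁺ (InW-≗ z∈W (sym ∘ z≗x)) (λ v → trans (w≗sz v) (cong (sAff R β k) (z≗x v)))
      (λ u (q , q∈A₊ , u≡xq) → above u (q , q∈A₊ , trans u≡xq (sym (z≗x q))))

  ≤a-trans : ∀ {y z x} → _≤a_ R y z → _≤a_ R z x → _≤a_ R y x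
  ≤a-trans y≤z (done x∈W z≗x)                 = ≤a-respʳ y≤z z≗x
  ≤a-trans y≤z (step β k z≤w β⁺ x∈W w≗sx above) = step β k (≤a-trans y≤z z≤w) β⁺ x∈W w≗sx above

  -- The order ⪯ implies the affine order

  simple-Pos : ∀ i → Pos R (simple i)
  simple-Pos i = simple∈Φ i , δ i , sym (ΣV-δ r i simple)

  t≤a-t⊕simple-coroot : ∀ {ν} → InCorootLattice R ν → ∀ i → _≤a_ R (t R ν) (t R (ν ⊕ coroot (simple i)))
  t≤a-t⊕simple-coroot {ν} ν∈ℤΦ^∨ i =
    step α L′ lower (simple-Pos i) (InW-t λ∈ℤΦ^∨) (λ v → refl) above-L
    where
    open ≡-Reasoning
    α = simple i
    α∈Φ = simple∈Φ i
    b = coroot α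
    λ′ = ν ⊕ b
    λ∈ℤΦ^∨ : InCorootLattice R λ′
    λ∈ℤΦ^∨ = subst (InCorootLattice R) (cong (ν ⊕_) (·-identityˡ b)) (lattice-+ ν∈ℤΦ^∨ (ℤ.+ 1) α∈Φ)
    L′ = proj₁ (⟨lattice∣root⟩∈ℤ λ∈ℤΦ^∨ α∈Φ)
    L = ℤ→ℚ L′
    K′ = L′ ℤ.+ -[1+ 0 ]
    K≡L-1 : ℤ→ℚ K′ ≡ L + (- 1ℚ)
    K≡L-1 = ℤ→ℚ-+ L′ -[1+ 0 ]
    ⟨⊕λ∣α⟩ : ∀ q → ⟨ q ⊕ λ′ ∣ α ⟩ ≡ ⟨ q ∣ α ⟩ + L
    ⟨⊕λ∣α⟩ q = trans (⟨⊕∣⟩ q λ′ α) (cong (⟨ q ∣ α ⟩ +_) (proj₂ (⟨lattice∣root⟩∈ℤ λ∈ℤΦ^∨ α∈Φ)))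
    middle : V r → V r
    middle v = sAff R α L′ (t R λ′ v)
    add-sub : ∀ {n} (v μ c : V n) → (v ⊕ (μ ⊕ c)) ⊕ ((- 1ℚ) · c) ≡ v ⊕ μ
    add-sub []      []      []      = refl
    add-sub (x ∷ v) (y ∷ μ) (z ∷ c) =
      cong₂ _∷_ (solve 3 (λ x y z → (x :+ (y :+ z)) :+ (:- con 1ℚ) :* z := x :+ y) refl x y z) (add-sub v μ c)
    t≡s∘middle : ∀ v → t R ν v ≡ sAff R α K′ (middle v)
    t≡s∘middle v = sym (begin
      sAff R α K′ (sAff R α L′ (v ⊕ λ′))  ≡⟨ sAff∘sAff α∈Φ K′ L′ (v ⊕ λ′) ⟩
      (v ⊕ λ′) ⊕ ((ℤ→ℚ K′ - L) · b)       ≡⟨ cong (λ s → (v ⊕ λ′) ⊕ (s · b))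
                                               (trans (cong (_- L) K≡L-1)
                                                 (solve 1 (λ l → (l :+ (:- con 1ℚ)) :- l := :- con 1ℚ) refl L)) ⟩
      (v ⊕ (ν ⊕ b)) ⊕ ((- 1ℚ) · b)        ≡⟨ add-sub v ν b ⟩
      v ⊕ ν                               ∎)
    above-K : ∀ u → InAlcove R middle u → ℤ→ℚ K′ < ⟨ u ∣ α ⟩
    above-K u (q , q∈A₊ , refl) =
      subst₂ _<_ (sym K≡L-1) (sym ⟨middle∣α⟩) (ℚP.+-mono-≤-< (ℚP.≤-refl {L}) (ℚP.neg-antimono-< (proj₂ (q∈A₊ (simple-Pos i)))))
      where
      ⟨middle∣α⟩ : ⟨ middle q ∣ α ⟩ ≡ L - ⟨ q ∣ α ⟩
      ⟨middle∣α⟩ = trans (⟨sAff∣root⟩ α∈Φ L′ (q ⊕ λ′)) (trans (cong (_-_ (L + L)) (⟨⊕λ∣α⟩ q))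
                     (solve 2 (λ l a → (l :+ l) :- (a :+ l) := l :- a) refl L ⟨ q ∣ α ⟩))
    lower : _≤a_ R (t R ν) middle
    lower = step α K′ (done (InW-t ν∈ℤΦ^∨) (λ v → refl)) (simple-Pos i)
                 (InW-∘ (InW-sAff L′ (simple-Pos i)) (InW-t λ∈ℤΦ^∨)) t≡s∘middle above-K
    above-L : ∀ u → InAlcove R (t R λ′) u → L < ⟨ u ∣ α ⟩
    above-L u (q , q∈A₊ , refl) =
      subst₂ _<_ (ℚP.+-identityˡ L) (sym (⟨⊕λ∣α⟩ q)) (ℚP.+-mono-<-≤ (proj₁ (q∈A₊ (simple-Pos i))) (ℚP.≤-refl {L}))

  t≤a-t⊕ℕsimple-coroot : ∀ n {ν} → InCorootLattice R ν → ∀ i →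
                         _≤a_ R (t R ν) (t R (ν ⊕ (ℕ→ℚ n · coroot (simple i))))
  t≤a-t⊕ℕsimple-coroot zero    {ν} ν∈ℤΦ^∨ i =
    done (InW-≗ (InW-t ν∈ℤΦ^∨) (λ v → cong (v ⊕_) ν⊕0≡ν)) (λ v → cong (v ⊕_) (sym ν⊕0≡ν))
    where
    ν⊕0≡ν : ν ⊕ (0ℚ · coroot (simple i)) ≡ ν
    ν⊕0≡ν = trans (cong (ν ⊕_) (·-zeroˡ _)) (⊕-identityʳ ν)
  t≤a-t⊕ℕsimple-coroot (suc n) {ν} ν∈ℤΦ^∨ i =
    ≤a-trans (t≤a-t⊕ℕsimple-coroot n ν∈ℤΦ^∨ i)
      (≤a-respʳ (t≤a-t⊕simple-coroot (lattice-+ ν∈ℤΦ^∨ (ℤ.+ n) (simple∈Φ i)) i)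
        (λ v → cong (v ⊕_) one-more))
    where
    open ≡-Reasoning
    b = coroot (simple i)
    one-more : (ν ⊕ (ℕ→ℚ n · b)) ⊕ b ≡ ν ⊕ (ℕ→ℚ (suc n) · b)
    one-more = begin
      (ν ⊕ (ℕ→ℚ n · b)) ⊕ b              ≡⟨ ⊕-assoc ν _ b ⟩
      ν ⊕ ((ℕ→ℚ n · b) ⊕ b)              ≡⟨ cong (λ c → ν ⊕ ((ℕ→ℚ n · b) ⊕ c)) (·-identityˡ b) ⟨
      ν ⊕ ((ℕ→ℚ n · b) ⊕ (1ℚ · b))       ≡⟨ cong (ν ⊕_) (·-distribʳ-+ (ℕ→ℚ n) 1ℚ b) ⟨
      ν ⊕ ((ℕ→ℚ n + 1ℚ) · b)             ≡⟨ cong (λ q → ν ⊕ (q · b)) (ℕ→ℚ-+ n 1) ⟨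
      ν ⊕ (ℕ→ℚ (n ℕ.+ 1) · b)            ≡⟨ cong (λ m → ν ⊕ (ℕ→ℚ m · b)) (ℕP.+-comm n 1) ⟩
      ν ⊕ (ℕ→ℚ (suc n) · b)              ∎

  t≤a-t⊕ΣℕsimpleCoroot : ∀ m (f : Fin m → Fin r) (c : Fin m → ℕ) {ν} → InCorootLattice R ν →
    _≤a_ R (t R ν) (t R (ν ⊕ ΣV m (λ j → ℕ→ℚ (c j) · coroot (simple (f j)))))
  t≤a-t⊕ΣℕsimpleCoroot zero    f c {ν} ν∈ℤΦ^∨ =
    done (InW-≗ (InW-t ν∈ℤΦ^∨) (λ v → cong (v ⊕_) (⊕-identityʳ ν))) (λ v → cong (v ⊕_) (sym (⊕-identityʳ ν)))
  t≤a-t⊕ΣℕsimpleCoroot (suc m) f c {ν} ν∈ℤΦ^∨ =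
    ≤a-trans (t≤a-t⊕ℕsimple-coroot (c zero) ν∈ℤΦ^∨ (f zero))
      (≤a-respʳ (t≤a-t⊕ΣℕsimpleCoroot m (f ∘ suc) (c ∘ suc)
                   (lattice-+ ν∈ℤΦ^∨ (ℤ.+ c zero) (simple∈Φ (f zero))))
                (λ v → cong (v ⊕_) (⊕-assoc ν _ _)))

  ⪯⇒≤a : ∀ μ λ′ → InCorootLattice R μ → _⪯_ R μ λ′ → _≤a_ R (t R μ) (t R λ′)
  ⪯⇒≤a μ λ′ μ∈ℤΦ^∨ (c , λ-μ≡) =
    ≤a-respʳ (t≤a-t⊕ΣℕsimpleCoroot r (λ j → j) c μ∈ℤΦ^∨)
             (λ v → cong (v ⊕_) (trans (cong (μ ⊕_) (sym λ-μ≡)) (⊕-⊖-cancel μ λ′)))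

  ⟨refl₀∣root⟩ : ∀ {α} → α ∈ Φ → ∀ v → ⟨ refl₀ α v ∣ α ⟩ ≡ - ⟨ v ∣ α ⟩
  ⟨refl₀∣root⟩ {α} α∈Φ v = begin
    ⟨ v ⊖ (x · coroot α) ∣ α ⟩       ≡⟨ ⟨⊖∣⟩ v (x · coroot α) α ⟩
    x - ⟨ x · coroot α ∣ α ⟩         ≡⟨ cong (_-_ x) (trans (⟨·∣⟩ x (coroot α) α) (cong (x *_) (⟨coroot∣root⟩≡2 α∈Φ))) ⟩
    x - x * 2ℚ                       ≡⟨ solve 1 (λ x → x :- x :* con 2ℚ := :- x) refl x ⟩
    - x                              ∎
    where
    open ≡-Reasoning
    x = ⟨ v ∣ α ⟩

  refl₀-involutive : ∀ {α} → α ∈ Φ → ∀ v → refl₀ α (refl₀ α v) ≡ v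
  refl₀-involutive {α} α∈Φ v = begin
    refl₀ α v ⊖ (⟨ refl₀ α v ∣ α ⟩ · b)   ≡⟨ cong (λ q → refl₀ α v ⊖ (q · b)) (⟨refl₀∣root⟩ α∈Φ v) ⟩
    (v ⊖ (x · b)) ⊖ ((- x) · b)           ≡⟨ cancel v b ⟩
    v                                     ∎
    where
    open ≡-Reasoning
    b = coroot α
    x = ⟨ v ∣ α ⟩
    cancel : ∀ {n} (v b : V n) → (v ⊖ (x · b)) ⊖ ((- x) · b) ≡ v
    cancel []      []      = refl
    cancel (y ∷ v) (z ∷ b) = cong₂ _∷_ (solve 3 (λ x y z → (y :- x :* z) :- (:- x) :* z := y) refl x y z) (cancel v b)

  refl₀-· : ∀ α c v → refl₀ α (c · v) ≡ c · refl₀ α v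
  refl₀-· α c v = begin
    (c · v) ⊖ (⟨ c · v ∣ α ⟩ · coroot α)   ≡⟨ cong (λ q → (c · v) ⊖ (q · coroot α)) (⟨·∣⟩ c v α) ⟩
    (c · v) ⊖ ((c * x) · coroot α)        ≡⟨ factor v (coroot α) ⟩
    c · (v ⊖ (x · coroot α))              ∎
    where
    open ≡-Reasoning
    x = ⟨ v ∣ α ⟩
    factor : ∀ {n} (v b : V n) → (c · v) ⊖ ((c * x) · b) ≡ c · (v ⊖ (x · b))
    factor []      []      = refl
    factor (y ∷ v) (z ∷ b) =
      cong₂ _∷_ (solve 4 (λ c x y z → c :* y :- (c :* x) :* z := c :* (y :- x :* z)) refl c x y z) (factor v b)

  refl₀-isometry : ∀ {α} → α ∈ Φ → ∀ v → ⟨ refl₀ α v ∣ refl₀ α v ⟩ ≡ ⟨ v ∣ v ⟩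
  refl₀-isometry {α} α∈Φ v = begin
    ⟨ v ⊖ (x · b) ∣ s ⟩                ≡⟨ ⟨⊖∣⟩ v (x · b) s ⟩
    ⟨ v ∣ s ⟩ - ⟨ x · b ∣ s ⟩          ≡⟨ cong₂ _-_ (⟨∣⊖⟩ v v (x · b)) (trans (⟨·∣⟩ x b s) (cong (x *_) ⟨b∣s⟩)) ⟩
    (⟨ v ∣ v ⟩ - ⟨ v ∣ x · b ⟩) - x * (c * - x)
                                       ≡⟨ cong (λ q → (⟨ v ∣ v ⟩ - q) - x * (c * - x))
                                            (trans (⟨∣·⟩ v x b) (cong (x *_) (⟨∣·⟩ v c α))) ⟩
    (⟨ v ∣ v ⟩ - x * (c * x)) - x * (c * - x)
                                       ≡⟨ solve 3 (λ n x c → (n :- x :* (c :* x)) :- x :* (c :* (:- x)) := n) refl ⟨ v ∣ v ⟩ x c ⟩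
    ⟨ v ∣ v ⟩                          ∎
    where
    open ≡-Reasoning
    b = coroot α
    c = 2ℚ * inv ⟨ α ∣ α ⟩
    x = ⟨ v ∣ α ⟩
    s = refl₀ α v
    ⟨b∣s⟩ : ⟨ b ∣ s ⟩ ≡ c * - x
    ⟨b∣s⟩ = trans (⟨·∣⟩ c α s) (cong (c *_) (trans (⟨∣⟩-sym α s) (⟨refl₀∣root⟩ α∈Φ v)))

  coroot-refl₀ : ∀ {α} → α ∈ Φ → ∀ β → coroot (refl₀ α β) ≡ refl₀ α (coroot β)
  coroot-refl₀ {α} α∈Φ β =
    trans (cong (λ q → (2ℚ * inv q) · refl₀ α β) (refl₀-isometry α∈Φ β)) (sym (refl₀-· α (2ℚ * inv ⟨ β ∣ β ⟩) β))

  coroot≡coroot-refl₀⊕ : ∀ {α} → α ∈ Φ → ∀ β →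
                          coroot β ≡ coroot (refl₀ α β) ⊕ (⟨ coroot β ∣ α ⟩ · coroot α)
  coroot≡coroot-refl₀⊕ {α} α∈Φ β = begin
    coroot β                                       ≡⟨ refl₀-involutive α∈Φ (coroot β) ⟨
    refl₀ α (refl₀ α (coroot β))                   ≡⟨ cong (refl₀ α) (coroot-refl₀ α∈Φ β) ⟨
    γ^∨ ⊖ (⟨ γ^∨ ∣ α ⟩ · coroot α)                 ≡⟨ cong (λ v → γ^∨ ⊖ (⟨ v ∣ α ⟩ · coroot α)) (coroot-refl₀ α∈Φ β) ⟩
    γ^∨ ⊖ (⟨ refl₀ α (coroot β) ∣ α ⟩ · coroot α)  ≡⟨ cong (λ q → γ^∨ ⊖ (q · coroot α)) (⟨refl₀∣root⟩ α∈Φ (coroot β)) ⟩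
    γ^∨ ⊖ ((- m) · coroot α)                       ≡⟨ sub-neg γ^∨ (coroot α) ⟩
    γ^∨ ⊕ (m · coroot α)                           ∎
    where
    open ≡-Reasoning
    γ^∨ = coroot (refl₀ α β)
    m = ⟨ coroot β ∣ α ⟩
    sub-neg : ∀ {n} (u w : V n) → u ⊖ ((- m) · w) ≡ u ⊕ (m · w)
    sub-neg []      []      = refl
    sub-neg (y ∷ u) (z ∷ w) = cong₂ _∷_ (solve 3 (λ m y z → y :- (:- m) :* z := y :+ m :* z) refl m y z) (sub-neg u w)

  refl₀≡⊕-pairing·root : ∀ α v → refl₀ α v ≡ v ⊕ ((- ⟨ v ∣ coroot α ⟩) · α)
  refl₀≡⊕-pairing·root α v =
    trans (regroup v α) (cong (λ q → v ⊕ ((- q) · α)) (sym (⟨∣·⟩ v c α)))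
    where
    c = 2ℚ * inv ⟨ α ∣ α ⟩
    x = ⟨ v ∣ α ⟩
    regroup : ∀ {n} (v w : V n) → v ⊖ (x · (c · w)) ≡ v ⊕ ((- (c * x)) · w)
    regroup []      []      = refl
    regroup (y ∷ v) (z ∷ w) =
      cong₂ _∷_ (solve 4 (λ y z x c → y :- x :* (c :* z) := y :+ (:- (c :* x)) :* z) refl y z x c) (regroup v w)

  -- Coroots of positive roots

  Σcoroot : (Fin r → ℚ) → V r
  Σcoroot a = ΣV r (λ j → a j · coroot (simple j))

  Inℕspan-Δ^∨ : V r → Set
  Inℕspan-Δ^∨ v = ∃ λ (d : Fin r → ℕ) → v ≡ Σcoroot (λ j → ℕ→ℚ (d j))

  simple-coroot∈ℕspan : ∀ i → Inℕspan-Δ^∨ (coroot (simple i))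
  simple-coroot∈ℕspan i = δ i , sym (ΣV-δ r i (coroot ∘ simple))

  ℕspan-⊕ℕsimple-coroot : ∀ {v} → Inℕspan-Δ^∨ v → ∀ m i → Inℕspan-Δ^∨ (v ⊕ (ℕ→ℚ m · coroot (simple i)))
  ℕspan-⊕ℕsimple-coroot {v} (d , v≡) m i = (λ j → d j ℕ.+ m ℕ.* δ i j) , (begin
    v ⊕ (ℕ→ℚ m · coroot (simple i))
      ≡⟨ cong₂ _⊕_ (sym v≡) (cong (ℕ→ℚ m ·_) (ΣV-δ r i (coroot ∘ simple))) ⟨
    Σcoroot (ℕ→ℚ ∘ d) ⊕ (ℕ→ℚ m · Σcoroot (λ j → ℕ→ℚ (δ i j)))
      ≡⟨ cong (Σcoroot (ℕ→ℚ ∘ d) ⊕_) (ΣV-* r (ℕ→ℚ m) (λ j → ℕ→ℚ (δ i j)) (coroot ∘ simple)) ⟨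
    Σcoroot (ℕ→ℚ ∘ d) ⊕ Σcoroot (λ j → ℕ→ℚ m * ℕ→ℚ (δ i j))
      ≡⟨ ΣV-+ r (ℕ→ℚ ∘ d) (λ j → ℕ→ℚ m * ℕ→ℚ (δ i j)) (coroot ∘ simple) ⟨
    Σcoroot (λ j → ℕ→ℚ (d j) + ℕ→ℚ m * ℕ→ℚ (δ i j))
      ≡⟨ ΣV-cong r (λ j → cong (_· coroot (simple j))
           (trans (ℕ→ℚ-+ (d j) (m ℕ.* δ i j)) (cong (ℕ→ℚ (d j) +_) (ℕ→ℚ-* m (δ i j))))) ⟨
    Σcoroot (λ j → ℕ→ℚ (d j ℕ.+ m ℕ.* δ i j))
      ∎)
    where open ≡-Reasoning

  -- (β | β) = Σⱼ cⱼ (αⱼ | β) > 0 forces some (β | αᵢ) > 0.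
  ∃-simple-pairing-pos : ∀ {β} → β ∈ Φ → (c : Fin r → ℕ) → β ≡ Σsimple (ℕ→ℚ ∘ c) →
                         ∃ λ i → 0ℚ < ⟨ β ∣ simple i ⟩
  ∃-simple-pairing-pos {β} β∈Φ c β≡ =
    map₂ ℚP.≰⇒> (FinP.¬∀⟶∃¬ r (λ i → ⟨ β ∣ simple i ⟩ ≤ 0ℚ) (λ i → ⟨ β ∣ simple i ⟩ ℚP.≤? 0ℚ) not-all-nonPos)
    where
    not-all-nonPos : ¬ (∀ i → ⟨ β ∣ simple i ⟩ ≤ 0ℚ)
    not-all-nonPos all-nonPos = ℚP.<-irrefl refl (ℚP.<-≤-trans (root-norm-pos β∈Φ) (subst (_≤ 0ℚ) (sym ⟨β∣β⟩≡) sum≤0))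
      where
      ⟨β∣β⟩≡ : ⟨ β ∣ β ⟩ ≡ ΣQ r (λ j → ℕ→ℚ (c j) * ⟨ β ∣ simple j ⟩)
      ⟨β∣β⟩≡ = trans (cong ⟨_∣ β ⟩ β≡) (trans (⟨ΣV∣⟩ r _ β)
                 (ΣQ-cong r (λ j → trans (⟨·∣⟩ (ℕ→ℚ (c j)) (simple j) β) (cong (ℕ→ℚ (c j) *_) (⟨∣⟩-sym (simple j) β)))))
      sum≤0 : ΣQ r (λ j → ℕ→ℚ (c j) * ⟨ β ∣ simple j ⟩) ≤ 0ℚ
      sum≤0 = ΣQ-nonPos r _ (λ j → subst (ℕ→ℚ (c j) * ⟨ β ∣ simple j ⟩ ≤_) (ℚP.*-zeroʳ (ℕ→ℚ (c j)))
                (ℚP.*-monoˡ-≤-nonNeg (ℕ→ℚ (c j)) {{ℚ.nonNegative (ℕ→ℚ-nonNeg (c j))}} (all-nonPos j)))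

  pairing-coroot>0 : ∀ {u} v → u ∈ Φ → 0ℚ < ⟨ v ∣ u ⟩ → 0ℚ < ⟨ v ∣ coroot u ⟩
  pairing-coroot>0 {u} v u∈Φ 0<⟨v∣u⟩ =
    subst (0ℚ <_) (sym (⟨∣·⟩ v (2ℚ * inv ⟨ u ∣ u ⟩) u)) (pos*pos (pos*pos 0<2 (inv-pos _ (root-norm-pos u∈Φ))) 0<⟨v∣u⟩)

  pairing-coroot∈ℕ : ∀ {u v} → u ∈ Φ → v ∈ Φ → 0ℚ ≤ ⟨ v ∣ coroot u ⟩ → Σ ℕ λ m → ⟨ v ∣ coroot u ⟩ ≡ ℕ→ℚ m
  pairing-coroot∈ℕ u∈Φ v∈Φ 0≤ with Φ-cryst u∈Φ v∈Φ
  ... | z , ⟨v∣u^∨⟩≡z with ℤ→ℚ-nonNeg⇒ℕ z (subst (0ℚ ≤_) ⟨v∣u^∨⟩≡z 0≤)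
  ...   | m , refl = m , ⟨v∣u^∨⟩≡z

  pairing-coroot∈ℕ⁺ : ∀ {u v} → u ∈ Φ → v ∈ Φ → 0ℚ < ⟨ v ∣ coroot u ⟩ → Σ ℕ λ n → ⟨ v ∣ coroot u ⟩ ≡ ℕ→ℚ (suc n)
  pairing-coroot∈ℕ⁺ u∈Φ v∈Φ 0< with Φ-cryst u∈Φ v∈Φ
  ... | z , ⟨v∣u^∨⟩≡z with ℤ→ℚ-pos⇒ℕ⁺ z (subst (0ℚ <_) ⟨v∣u^∨⟩≡z 0<)
  ...   | n , refl = n , ⟨v∣u^∨⟩≡z

  -- One descent step: γ = s_αᵢ β = β - N αᵢ with N = (β | αᵢ^∨) > 0, and β^∨ = γ^∨ + (β^∨ | αᵢ) αᵢ^∨.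
  module Descent {β} (β∈Φ : β ∈ Φ) (c : Fin r → ℕ) (β≡ : β ≡ Σsimple (ℕ→ℚ ∘ c))
                 (i : Fin r) (pairing>0 : 0ℚ < ⟨ β ∣ simple i ⟩) where
    α = simple i
    α∈Φ = simple∈Φ i
    γ = refl₀ α β

    γ∈Φ : γ ∈ Φ
    γ∈Φ = Φ-refl α∈Φ β∈Φ

    N-1 : ℕ
    N-1 = proj₁ (pairing-coroot∈ℕ⁺ α∈Φ β∈Φ (pairing-coroot>0 β α∈Φ pairing>0))

    N = ℕ→ℚ (suc N-1)

    ⟨β∣α^∨⟩≡N : ⟨ β ∣ coroot α ⟩ ≡ N
    ⟨β∣α^∨⟩≡N = proj₂ (pairing-coroot∈ℕ⁺ α∈Φ β∈Φ (pairing-coroot>0 β α∈Φ pairing>0))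

    a : Fin r → ℚ
    a j = ℕ→ℚ (c j) + (- N) * ℕ→ℚ (δ i j)

    γ≡Σsimple-a : γ ≡ Σsimple a
    γ≡Σsimple-a = begin
      γ                                                        ≡⟨ refl₀≡⊕-pairing·root α β ⟩
      β ⊕ ((- ⟨ β ∣ coroot α ⟩) · α)                           ≡⟨ cong₂ (λ v q → v ⊕ ((- q) · α)) β≡ ⟨β∣α^∨⟩≡N ⟩
      Σsimple (ℕ→ℚ ∘ c) ⊕ ((- N) · α)                          ≡⟨ cong (λ v → Σsimple (ℕ→ℚ ∘ c) ⊕ ((- N) · v)) (ΣV-δ r i simple) ⟨
      Σsimple (ℕ→ℚ ∘ c) ⊕ ((- N) · Σsimple (ℕ→ℚ ∘ δ i))        ≡⟨ cong (Σsimple (ℕ→ℚ ∘ c) ⊕_) (ΣV-* r (- N) (ℕ→ℚ ∘ δ i) simple) ⟨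
      Σsimple (ℕ→ℚ ∘ c) ⊕ Σsimple (λ j → (- N) * ℕ→ℚ (δ i j))  ≡⟨ ΣV-+ r (ℕ→ℚ ∘ c) (λ j → (- N) * ℕ→ℚ (δ i j)) simple ⟨
      Σsimple a                                                ∎
      where open ≡-Reasoning

    a-off : ∀ j → j ≢ i → a j ≡ ℕ→ℚ (c j)
    a-off j j≢i = trans (cong (λ d → ℕ→ℚ (c j) + (- N) * ℕ→ℚ d) (δ-off i j j≢i))
                        (solve 2 (λ x n → x :+ (:- n) :* con 0ℚ := x) refl (ℕ→ℚ (c j)) N)

    a-diag : a i + N ≡ ℕ→ℚ (c i)
    a-diag = trans (cong (λ d → ℕ→ℚ (c i) + (- N) * ℕ→ℚ d + N) (δ-diag i))
                   (solve 2 (λ x n → x :+ (:- n) :* con 1ℚ :+ n := x) refl (ℕ→ℚ (c i)) N)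

    height-drop : ∀ e → γ ≡ Σsimple (ℕ→ℚ ∘ e) → ΣN r e ℕ.< ΣN r c
    height-drop e γ≡ = subst (ΣN r e ℕ.<_) (ΣN-lower r i e c (suc N-1) e-off e-diag) (ℕP.m<m+n (ΣN r e) (ℕ.s≤s ℕ.z≤n))
      where
      e≡a : ∀ j → ℕ→ℚ (e j) ≡ a j
      e≡a = Σsimple-injective (ℕ→ℚ ∘ e) a (trans (sym γ≡) γ≡Σsimple-a)
      e-off : ∀ j → j ≢ i → e j ≡ c j
      e-off j j≢i = ℕ→ℚ-injective (trans (e≡a j) (a-off j j≢i))
      e-diag : e i ℕ.+ suc N-1 ≡ c i
      e-diag = ℕ→ℚ-injective (trans (ℕ→ℚ-+ (e i) (suc N-1)) (trans (cong (_+ N) (e≡a i)) a-diag))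

    coroot-from-γ : Inℕspan-Δ^∨ (coroot γ) → Inℕspan-Δ^∨ (coroot β)
    coroot-from-γ γ^∨∈ = subst Inℕspan-Δ^∨ (sym β^∨≡) (ℕspan-⊕ℕsimple-coroot γ^∨∈ m i)
      where
      m,⟨α∣β^∨⟩≡m : Σ ℕ λ m → ⟨ α ∣ coroot β ⟩ ≡ ℕ→ℚ m
      m,⟨α∣β^∨⟩≡m = pairing-coroot∈ℕ β∈Φ α∈Φ
                      (ℚP.<⇒≤ (pairing-coroot>0 α β∈Φ (subst (0ℚ <_) (⟨∣⟩-sym β α) pairing>0)))
      m = proj₁ m,⟨α∣β^∨⟩≡m
      β^∨≡ : coroot β ≡ coroot γ ⊕ (ℕ→ℚ m · coroot α)
      β^∨≡ = trans (coroot≡coroot-refl₀⊕ α∈Φ β)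
               (cong (λ q → coroot γ ⊕ (q · coroot α)) (trans (⟨∣⟩-sym (coroot β) α) (proj₂ m,⟨α∣β^∨⟩≡m)))

    -- s_αᵢ only makes multiples of αᵢ negative, and by reducedness the only positive one in Φ is αᵢ.
    multiple-if-γ-negative : ∀ e → γ ≡ (- 1ℚ) · Σsimple (ℕ→ℚ ∘ e) → β ≡ ℕ→ℚ (c i) · α
    multiple-if-γ-negative e γ≡ = trans β≡ (ΣV-single r i (ℕ→ℚ ∘ c) simple λ j j≢i →
      cong ℕ→ℚ (ℕ→ℚ≡-ℕ→ℚ⇒≡0 (c j) (e j) (trans (sym (a-off j j≢i)) (a≡-e j))))
      where
      a≡-e : ∀ j → a j ≡ (- 1ℚ) * ℕ→ℚ (e j)
      a≡-e = Σsimple-injective a (λ j → (- 1ℚ) * ℕ→ℚ (e j))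
               (trans (sym γ≡Σsimple-a) (trans γ≡ (sym (ΣV-* r (- 1ℚ) (ℕ→ℚ ∘ e) simple))))

    simple-if-γ-negative : ∀ e → γ ≡ (- 1ℚ) · Σsimple (ℕ→ℚ ∘ e) → Inℕspan-Δ^∨ (coroot β)
    simple-if-γ-negative e γ≡ =
      [ (λ cᵢ≡1 → subst (Inℕspan-Δ^∨ ∘ coroot) (sym (trans β≡cᵢα (trans (cong (_· α) cᵢ≡1) (·-identityˡ α))))
                        (simple-coroot∈ℕspan i))
      , (λ cᵢ≡-1 → ⊥-elim (0≰-1 (subst (0ℚ ≤_) cᵢ≡-1 (ℕ→ℚ-nonNeg (c i)))))
      ]′ (Φ-reduced (ℕ→ℚ (c i)) α∈Φ (subst (_∈ Φ) β≡cᵢα β∈Φ))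
      where
      β≡cᵢα : β ≡ ℕ→ℚ (c i) · α
      β≡cᵢα = multiple-if-γ-negative e γ≡

  HeightClaim : ℕ → Set
  HeightClaim h = ∀ {β} → β ∈ Φ → (c : Fin r → ℕ) → β ≡ Σsimple (ℕ→ℚ ∘ c) → ΣN r c ≡ h →
                  Inℕspan-Δ^∨ (coroot β)

  coroot∈ℕspan-by-height : ∀ h → HeightClaim h
  coroot∈ℕspan-by-height = <-rec HeightClaim descend
    where
    descend : ∀ h → (∀ {h′} → h′ ℕ.< h → HeightClaim h′) → HeightClaim h
    descend _ IH β∈Φ c β≡ refl =
      let i , pairing>0 = ∃-simple-pairing-pos β∈Φ c β≡
          open Descent β∈Φ c β≡ i pairing>0
          e , γ-sign = simple-base γ∈Φ
      in [ (λ γ≡ → coroot-from-γ (IH (height-drop e γ≡) γ∈Φ e γ≡ refl))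
         , simple-if-γ-negative e
         ]′ γ-sign

  coroot-Pos : ∀ {β} → Pos R β → Inℕspan-Δ^∨ (coroot β)
  coroot-Pos (β∈Φ , c , β≡) = coroot∈ℕspan-by-height _ β∈Φ c β≡ refl

  -- A point of the fundamental alcove

  PrescribedPairings : ℕ → Set
  PrescribedPairings k = (t : Fin r → ℚ) → ∃ λ a → (∀ j → k ℕ.≤ toℕ j → a j ≡ 0ℚ)
                                                 × (∀ i → toℕ i ℕ.< k → ⟨ Σsimple a ∣ simple i ⟩ ≡ t i)

  -- Adjust by the component of α_k orthogonal to α₀,…,α_{k-1}.
  module Extend (k : ℕ) (k<r : k ℕ.< r) (prescribe : PrescribedPairings k) where
    K : Fin r
    K = Fin.fromℕ< k<r

    toℕK≡k : toℕ K ≡ k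
    toℕK≡k = FinP.toℕ-fromℕ< k<r

    below-or-above : ∀ j → j ≢ K → toℕ j ℕ.< k ⊎ k ℕ.< toℕ j
    below-or-above j j≢K with ℕP.<-cmp (toℕ j) k
    ... | tri< j<k _ _ = inj₁ j<k
    ... | tri≈ _ j≡k _ = ⊥-elim (j≢K (FinP.toℕ-injective (trans j≡k (sym toℕK≡k))))
    ... | tri> _ _ k<j = inj₂ k<j

    b = proj₁ (prescribe (λ i → ⟨ simple K ∣ simple i ⟩))

    cw : Fin r → ℚ
    cw j = ℕ→ℚ (δ K j) + (- 1ℚ) * b j

    w = Σsimple cw

    w⊥ : ∀ i → toℕ i ℕ.< k → ⟨ w ∣ simple i ⟩ ≡ 0ℚ
    w⊥ i i<k = begin
      ⟨ w ∣ simple i ⟩                                   ≡⟨ cong ⟨_∣ simple i ⟩ w≡ ⟩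
      ⟨ simple K ⊕ ((- 1ℚ) · Σsimple b) ∣ simple i ⟩     ≡⟨ ⟨⊕∣⟩ (simple K) _ (simple i) ⟩
      ⟨ simple K ∣ simple i ⟩ + ⟨ (- 1ℚ) · Σsimple b ∣ simple i ⟩
                                                         ≡⟨ cong (⟨ simple K ∣ simple i ⟩ +_)
                                                              (trans (⟨·∣⟩ (- 1ℚ) (Σsimple b) (simple i))
                                                                (cong ((- 1ℚ) *_) (proj₂ (proj₂ (prescribe _)) i i<k))) ⟩
      ⟨ simple K ∣ simple i ⟩ + (- 1ℚ) * ⟨ simple K ∣ simple i ⟩
                                                         ≡⟨ solve 1 (λ x → x :+ (:- con 1ℚ) :* x := con 0ℚ) refl ⟨ simple K ∣ simple i ⟩ ⟩
      0ℚ                                                 ∎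
      where
      open ≡-Reasoning
      w≡ : w ≡ simple K ⊕ ((- 1ℚ) · Σsimple b)
      w≡ = trans (ΣV-+ r (ℕ→ℚ ∘ δ K) (λ j → (- 1ℚ) * b j) simple)
                 (cong₂ _⊕_ (ΣV-δ r K simple) (ΣV-* r (- 1ℚ) b simple))

    cw-K : cw K ≡ 1ℚ
    cw-K = trans (cong₂ (λ d q → ℕ→ℚ d + (- 1ℚ) * q) (δ-diag K) (proj₁ (proj₂ (prescribe _)) K (ℕP.≤-reflexive (sym toℕK≡k))))
                 (solve 0 (con 1ℚ :+ (:- con 1ℚ) :* con 0ℚ := con 1ℚ) refl)

    cw-above : ∀ j → k ℕ.< toℕ j → cw j ≡ 0ℚ
    cw-above j k<j =
      trans (cong₂ (λ d q → ℕ→ℚ d + (- 1ℚ) * q)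
                   (δ-off K j (λ { refl → ℕP.<⇒≢ k<j (sym toℕK≡k) }))
                   (proj₁ (proj₂ (prescribe _)) j (ℕP.<⇒≤ k<j)))
            (solve 0 (con 0ℚ :+ (:- con 1ℚ) :* con 0ℚ := con 0ℚ) refl)

    ⟨w∣w⟩≡⟨αK∣w⟩ : ⟨ w ∣ w ⟩ ≡ ⟨ simple K ∣ w ⟩
    ⟨w∣w⟩≡⟨αK∣w⟩ =
      trans (⟨ΣV∣⟩ r (λ j → cw j · simple j) w)
        (trans (ΣQ-single r K (λ j → ⟨ cw j · simple j ∣ w ⟩) off-K)
          (trans (⟨·∣⟩ (cw K) (simple K) w) (trans (cong (_* ⟨ simple K ∣ w ⟩) cw-K) (ℚP.*-identityˡ _))))
      where
      off-K : ∀ j → j ≢ K → ⟨ cw j · simple j ∣ w ⟩ ≡ 0ℚ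
      off-K j j≢K = trans (⟨·∣⟩ (cw j) (simple j) w)
        ([ (λ j<k → trans (cong (cw j *_) (trans (⟨∣⟩-sym (simple j) w) (w⊥ j j<k))) (ℚP.*-zeroʳ (cw j)))
         , (λ k<j → trans (cong (_* ⟨ simple j ∣ w ⟩) (cw-above j k<j)) (ℚP.*-zeroˡ ⟨ simple j ∣ w ⟩))
         ]′ (below-or-above j j≢K))

    0<⟨w∣w⟩ : 0ℚ < ⟨ w ∣ w ⟩
    0<⟨w∣w⟩ = G-posdef w λ w≡𝟘 →
      ℚP.1≢0 (trans (sym cw-K) (Σsimple-injective cw (λ _ → 0ℚ) (trans w≡𝟘 (sym (ΣV-zero r simple))) K))

    extend : PrescribedPairings (suc k)
    extend t = a′ , a′-above , a′-pairing
      where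
      a = proj₁ (prescribe t)
      A = ⟨ Σsimple a ∣ simple K ⟩
      s = (t K - A) * inv ⟨ w ∣ w ⟩
      a′ : Fin r → ℚ
      a′ j = a j + s * cw j
      a′-above : ∀ j → suc k ℕ.≤ toℕ j → a′ j ≡ 0ℚ
      a′-above j k<j = trans (cong₂ (λ x y → x + s * y) (proj₁ (proj₂ (prescribe t)) j (ℕP.<⇒≤ k<j)) (cw-above j k<j))
                             (trans (ℚP.+-identityˡ _) (ℚP.*-zeroʳ s))
      ⟨a′∣⟩ : ∀ i → ⟨ Σsimple a′ ∣ simple i ⟩ ≡ ⟨ Σsimple a ∣ simple i ⟩ + s * ⟨ w ∣ simple i ⟩
      ⟨a′∣⟩ i = trans (cong ⟨_∣ simple i ⟩ (trans (ΣV-+ r a (λ j → s * cw j) simple) (cong (Σsimple a ⊕_) (ΣV-* r s cw simple))))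
                  (trans (⟨⊕∣⟩ (Σsimple a) (s · w) (simple i)) (cong (⟨ Σsimple a ∣ simple i ⟩ +_) (⟨·∣⟩ s w (simple i))))
      a′-pairing-K : ⟨ Σsimple a′ ∣ simple K ⟩ ≡ t K
      a′-pairing-K = begin
        ⟨ Σsimple a′ ∣ simple K ⟩                    ≡⟨ ⟨a′∣⟩ K ⟩
        A + s * ⟨ w ∣ simple K ⟩                     ≡⟨ cong (λ q → A + s * q) (trans (⟨∣⟩-sym w (simple K)) (sym ⟨w∣w⟩≡⟨αK∣w⟩)) ⟩
        A + (t K - A) * inv ⟨ w ∣ w ⟩ * ⟨ w ∣ w ⟩    ≡⟨ solve 4 (λ A T i n → A :+ (T :- A) :* i :* n := A :+ (T :- A) :* (n :* i))
                                                          refl A (t K) (inv ⟨ w ∣ w ⟩) ⟨ w ∣ w ⟩ ⟩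
        A + (t K - A) * (⟨ w ∣ w ⟩ * inv ⟨ w ∣ w ⟩)  ≡⟨ cong (λ q → A + (t K - A) * q) (inv-inverseʳ _ 0<⟨w∣w⟩) ⟩
        A + (t K - A) * 1ℚ                           ≡⟨ solve 2 (λ A T → A :+ (T :- A) :* con 1ℚ := T) refl A (t K) ⟩
        t K                                          ∎
        where open ≡-Reasoning
      a′-pairing : ∀ i → toℕ i ℕ.< suc k → ⟨ Σsimple a′ ∣ simple i ⟩ ≡ t i
      a′-pairing i i≤k with ℕP.m<1+n⇒m<n∨m≡n i≤k
      ... | inj₁ i<k = trans (⟨a′∣⟩ i) (trans (cong₂ (λ x y → x + s * y) (proj₂ (proj₂ (prescribe t)) i i<k) (w⊥ i i<k))
                                         (trans (cong (t i +_) (ℚP.*-zeroʳ s)) (ℚP.+-identityʳ (t i))))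
      ... | inj₂ i≡k = subst (λ j → ⟨ Σsimple a′ ∣ simple j ⟩ ≡ t j) (FinP.toℕ-injective (trans toℕK≡k (sym i≡k))) a′-pairing-K

  prescribed-pairings : ∀ k → k ℕ.≤ r → PrescribedPairings k
  prescribed-pairings zero    _     t = (λ _ → 0ℚ) , (λ _ _ → refl) , (λ _ ())
  prescribed-pairings (suc k) k<r     = Extend.extend k k<r (prescribed-pairings k (ℕP.<⇒≤ k<r))

  ∃-constant-pairing : ∀ ε → ∃ λ p → ∀ i → ⟨ p ∣ simple i ⟩ ≡ ε
  ∃-constant-pairing ε = Σsimple (proj₁ solution) , λ i → proj₂ (proj₂ solution) i (FinP.toℕ<n i)
    where solution = prescribed-pairings r ℕP.≤-refl (λ _ → ε)

  HeightAtMost : V r → ℕ → Set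
  HeightAtMost α H = ∀ c → α ≡ Σsimple (ℕ→ℚ ∘ c) → ΣN r c ℕ.≤ H

  -- By uniqueness of expansions, an ℕ-expansion of a root is its base expansion if the root is positive,
  -- and zero if it is negative.
  root-height-bounded : ∀ {α} → α ∈ Φ → ∃ (HeightAtMost α)
  root-height-bounded α∈Φ with simple-base α∈Φ
  ... | c₀ , inj₁ α≡ = ΣN r c₀ , λ c α≡c → ℕP.≤-reflexive (ΣN-cong r λ j →
          ℕ→ℚ-injective (Σsimple-injective (ℕ→ℚ ∘ c) (ℕ→ℚ ∘ c₀) (trans (sym α≡c) α≡) j))
  ... | c₀ , inj₂ α≡ = ΣN r c₀ , λ c α≡c → ℕP.≤-trans (ℕP.≤-reflexive (≡0⇒ΣN≡0 r c λ j →
          ℕ→ℚ≡-ℕ→ℚ⇒≡0 (c j) (c₀ j) (Σsimple-injective (ℕ→ℚ ∘ c) (λ j → (- 1ℚ) * ℕ→ℚ (c₀ j))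
            (trans (sym α≡c) (trans α≡ (sym (ΣV-* r (- 1ℚ) (ℕ→ℚ ∘ c₀) simple)))) j))) ℕ.z≤n

  -- Pair every simple root with 1/(H+1), where H bounds the heights of all roots.
  A₊-nonempty : ∃ (InA₊ R)
  A₊-nonempty = p , λ { (α∈Φ , c , α≡) → 0<⟨p∣α⟩ α∈Φ c α≡ (ΣN r c) refl , ⟨p∣α⟩<1 α∈Φ c α≡ }
    where
    bound : ∃ λ H → ∀ {α} → α ∈ Φ → HeightAtMost α H
    bound = uniform-bound HeightAtMost (λ m≤n h c α≡ → ℕP.≤-trans (h c α≡) m≤n) Φ root-height-bounded
    H = proj₁ bound
    ε = inv (ℕ→ℚ (suc H))
    0<ε : 0ℚ < ε
    0<ε = inv-pos _ (ℕ→ℚ-pos H)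
    p = proj₁ (∃-constant-pairing ε)
    ⟨p∣α⟩≡ : ∀ {α} (c : Fin r → ℕ) → α ≡ Σsimple (ℕ→ℚ ∘ c) → ⟨ p ∣ α ⟩ ≡ ε * ℕ→ℚ (ΣN r c)
    ⟨p∣α⟩≡ {α} c α≡ = begin
      ⟨ p ∣ α ⟩                                       ≡⟨ trans (⟨∣⟩-sym p α) (cong ⟨_∣ p ⟩ α≡) ⟩
      ⟨ Σsimple (ℕ→ℚ ∘ c) ∣ p ⟩                        ≡⟨ ⟨ΣV∣⟩ r _ p ⟩
      ΣQ r (λ j → ⟨ ℕ→ℚ (c j) · simple j ∣ p ⟩)       ≡⟨ ΣQ-cong r (λ j → trans (⟨·∣⟩ (ℕ→ℚ (c j)) (simple j) p)
                                                           (trans (cong (ℕ→ℚ (c j) *_) (trans (⟨∣⟩-sym (simple j) p)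
                                                             (proj₂ (∃-constant-pairing ε) j))) (ℚP.*-comm (ℕ→ℚ (c j)) ε))) ⟩
      ΣQ r (λ j → ε * ℕ→ℚ (c j))                      ≡⟨ ΣQ-* r ε (ℕ→ℚ ∘ c) ⟩
      ε * ΣQ r (ℕ→ℚ ∘ c)                              ≡⟨ cong (ε *_) (ℕ→ℚ-ΣN r c) ⟨
      ε * ℕ→ℚ (ΣN r c)                                ∎
      where open ≡-Reasoning
    0<⟨p∣α⟩ : ∀ {α} → α ∈ Φ → (c : Fin r → ℕ) → α ≡ Σsimple (ℕ→ℚ ∘ c) → ∀ h → ΣN r c ≡ h → 0ℚ < ⟨ p ∣ α ⟩
    0<⟨p∣α⟩ α∈Φ c α≡ zero    height≡0 = ⊥-elim (Φ-nonzero (subst (_∈ Φ) α≡𝟘 α∈Φ))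
      where
      α≡𝟘 = trans α≡ (trans (ΣV-cong r (λ j → cong (λ n → ℕ→ℚ n · simple j) (ΣN≡0⇒≡0 r c height≡0 j))) (ΣV-zero r simple))
    0<⟨p∣α⟩ α∈Φ c α≡ (suc h) height≡ =
      subst (0ℚ <_) (sym (trans (⟨p∣α⟩≡ c α≡) (cong (λ n → ε * ℕ→ℚ n) height≡))) (pos*pos 0<ε (ℕ→ℚ-pos h))
    ⟨p∣α⟩<1 : ∀ {α} → α ∈ Φ → (c : Fin r → ℕ) → α ≡ Σsimple (ℕ→ℚ ∘ c) → ⟨ p ∣ α ⟩ < 1ℚ
    ⟨p∣α⟩<1 α∈Φ c α≡ =
      subst₂ _<_ (sym (⟨p∣α⟩≡ c α≡)) (trans (ℚP.*-comm ε _) (inv-inverseʳ _ (ℕ→ℚ-pos H)))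
        (ℚP.*-monoʳ-<-pos ε {{ℚ.positive 0<ε}} (ℕ→ℚ-mono-< (ℕ.s≤s (proj₂ bound α∈Φ c α≡))))

  Σcoroot-+ : ∀ a b → Σcoroot a ⊕ Σcoroot b ≡ Σcoroot (λ j → a j + b j)
  Σcoroot-+ a b = sym (ΣV-+ r a b (coroot ∘ simple))

  Σcoroot-· : ∀ c a → c · Σcoroot a ≡ Σcoroot (λ j → c * a j)
  Σcoroot-· c a = sym (ΣV-* r c a (coroot ∘ simple))

  Σcoroot-injective : ∀ a b → Σcoroot a ≡ Σcoroot b → ∀ j → a j ≡ b j
  Σcoroot-injective a b eq j =
    *-cancelʳ-pos (pos*pos 0<2 (inv-pos _ (root-norm-pos (simple∈Φ j))))
      (Σsimple-injective (λ j → a j * d j) (λ j → b j * d j) (trans (as-Σsimple a) (trans eq (sym (as-Σsimple b)))) j)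
    where
    d : Fin r → ℚ
    d j = 2ℚ * inv ⟨ simple j ∣ simple j ⟩
    as-Σsimple : ∀ a → Σsimple (λ j → a j * d j) ≡ Σcoroot a
    as-Σsimple a = ΣV-cong r (λ j → ·-assoc (a j) (d j) (simple j))

  -- The affine order implies ⪯

  Cone : V r → Set
  Cone v = ∃ λ (q : Fin r → ℚ) → (∀ i → 0ℚ ≤ q i) × v ≡ Σcoroot q

  cone-𝟘 : Cone 𝟘
  cone-𝟘 = (λ _ → 0ℚ) , (λ _ → ℚP.≤-refl) , sym (ΣV-zero r (coroot ∘ simple))

  cone-⊕ : ∀ {u v} → Cone u → Cone v → Cone (u ⊕ v)
  cone-⊕ (q , 0≤q , u≡) (q′ , 0≤q′ , v≡) =
    (λ i → q i + q′ i) , (λ i → subst (_≤ q i + q′ i) (ℚP.+-identityʳ 0ℚ) (ℚP.+-mono-≤ (0≤q i) (0≤q′ i))) , trans (cong₂ _⊕_ u≡ v≡) (Σcoroot-+ q q′)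

  cone-· : ∀ {v} c → 0ℚ ≤ c → Cone v → Cone (c · v)
  cone-· c 0≤c (q , 0≤q , v≡) = (λ i → c * q i) , (λ i → nonNeg*nonNeg 0≤c (0≤q i)) , trans (cong (c ·_) v≡) (Σcoroot-· c q)

  cone-coroot : ∀ {β} → Pos R β → Cone (coroot β)
  cone-coroot β⁺ = ℕ→ℚ ∘ proj₁ (coroot-Pos β⁺) , ℕ→ℚ-nonNeg ∘ proj₁ (coroot-Pos β⁺) , proj₂ (coroot-Pos β⁺)

  ≤a⇒cone : ∀ {p} → InA₊ R p → ∀ {y x} → _≤a_ R y x → Cone (x p ⊖ y p)
  ≤a⇒cone {p} p∈A₊ {y} {x} (done _ y≗x) =
    subst Cone (sym (trans (cong (x p ⊖_) (y≗x p)) (⊖-self (x p)))) cone-𝟘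
  ≤a⇒cone {p} p∈A₊ {y} {x} (step {z = z} β k y≤z β⁺ _ z≗sx above) =
    subst Cone (sym split)
      (cone-⊕ (cone-· _ (<⇒0≤- (above (x p) (p , p∈A₊ , refl))) (cone-coroot β⁺)) (≤a⇒cone p∈A₊ y≤z))
    where
    s = ⟨ x p ∣ β ⟩
    K = ℤ→ℚ k
    regroup : ∀ {n} (X Y b : V n) → X ⊖ Y ≡ ((s - K) · b) ⊕ ((X ⊕ ((K - s) · b)) ⊖ Y)
    regroup []      []      []      = refl
    regroup (x ∷ X) (y ∷ Y) (z ∷ b) =
      cong₂ _∷_ (solve 5 (λ x y z K s → x :- y := (s :- K) :* z :+ ((x :+ (K :- s) :* z) :- y)) refl x y z K s)
                (regroup X Y b)
    split : x p ⊖ y p ≡ ((s - K) · coroot β) ⊕ (z p ⊖ y p)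
    split = trans (regroup (x p) (y p) (coroot β)) (cong (λ v → ((s - K) · coroot β) ⊕ (v ⊖ y p)) (sym (z≗sx p)))

  Inℤspan-Δ^∨ : V r → Set
  Inℤspan-Δ^∨ v = ∃ λ (n : Fin r → ℤ) → v ≡ Σcoroot (ℤ→ℚ ∘ n)

  ℤspan-⊕ : ∀ {u v} → Inℤspan-Δ^∨ u → Inℤspan-Δ^∨ v → Inℤspan-Δ^∨ (u ⊕ v)
  ℤspan-⊕ (n , u≡) (n′ , v≡) = (λ j → n j ℤ.+ n′ j) ,
    trans (cong₂ _⊕_ u≡ v≡) (trans (Σcoroot-+ (ℤ→ℚ ∘ n) (ℤ→ℚ ∘ n′)) (ΣV-cong r (λ j → cong (_· coroot (simple j)) (sym (ℤ→ℚ-+ (n j) (n′ j))))))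

  ℤspan-· : ∀ {v} z → Inℤspan-Δ^∨ v → Inℤspan-Δ^∨ (ℤ→ℚ z · v)
  ℤspan-· z (n , v≡) = (λ j → z ℤ.* n j) ,
    trans (cong (ℤ→ℚ z ·_) v≡) (trans (Σcoroot-· (ℤ→ℚ z) (ℤ→ℚ ∘ n)) (ΣV-cong r (λ j → cong (_· coroot (simple j)) (sym (ℤ→ℚ-* z (n j))))))

  ℤspan-⊖ : ∀ {u v} → Inℤspan-Δ^∨ u → Inℤspan-Δ^∨ v → Inℤspan-Δ^∨ (u ⊖ v)
  ℤspan-⊖ {u} {v} u∈ v∈ = subst Inℤspan-Δ^∨ (sym (⊖≡⊕-neg u v)) (ℤspan-⊕ u∈ (ℤspan-· -[1+ 0 ] v∈))

  coroot∈ℤspan : ∀ {γ} → γ ∈ Φ → Inℤspan-Δ^∨ (coroot γ)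
  coroot∈ℤspan γ∈Φ = by-sign (Φ⊆Φ⁺∪-Φ⁺ γ∈Φ)
    where
    by-sign : ∀ {γ} → ∃ (λ β → Pos R β × (γ ≡ β ⊎ γ ≡ (- 1ℚ) · β)) → Inℤspan-Δ^∨ (coroot γ)
    by-sign (β , β⁺ , inj₁ refl) = ℤ.+_ ∘ proj₁ (coroot-Pos β⁺) , proj₂ (coroot-Pos β⁺)
    by-sign (β , β⁺ , inj₂ refl) = subst Inℤspan-Δ^∨ (sym (coroot-neg β))
                                     (ℤspan-· -[1+ 0 ] (ℤ.+_ ∘ proj₁ (coroot-Pos β⁺) , proj₂ (coroot-Pos β⁺)))

  lattice∈ℤspan : ∀ {μ} → InCorootLattice R μ → Inℤspan-Δ^∨ μ
  lattice∈ℤspan ([] , [] , refl) = (λ _ → ℤ.+ 0) , sym (ΣV-zero r (coroot ∘ simple))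
  lattice∈ℤspan ((z , γ) ∷ c , γ∈Φ ∷ c⊆Φ , refl) =
    ℤspan-⊕ (ℤspan-· z (coroot∈ℤspan γ∈Φ)) (lattice∈ℤspan (c , c⊆Φ , refl))

  ≤a⇒⪯ : ∀ μ λ′ → InCorootLattice R μ → InCorootLattice R λ′ → _≤a_ R (t R μ) (t R λ′) → _⪯_ R μ λ′
  ≤a⇒⪯ μ λ′ μ∈ℤΦ^∨ λ∈ℤΦ^∨ tμ≤tλ = m , trans λ-μ≡ (ΣV-cong r λ j → cong (λ z → ℤ→ℚ z · coroot (simple j)) (n≡m j))
    where
    p = proj₁ A₊-nonempty
    cone : Cone (λ′ ⊖ μ)
    cone = subst Cone (⊕-⊖-⊕-cancelˡ p λ′ μ) (≤a⇒cone (proj₂ A₊-nonempty) tμ≤tλ)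
    q = proj₁ cone
    integral = ℤspan-⊖ (lattice∈ℤspan λ∈ℤΦ^∨) (lattice∈ℤspan μ∈ℤΦ^∨)
    n = proj₁ integral
    λ-μ≡ = proj₂ integral
    n≥0 : ∀ j → 0ℚ ≤ ℤ→ℚ (n j)
    n≥0 j = subst (0ℚ ≤_) (Σcoroot-injective q (ℤ→ℚ ∘ n) (trans (sym (proj₂ (proj₂ cone))) λ-μ≡) j) (proj₁ (proj₂ cone) j)
    m : Fin r → ℕ
    m j = proj₁ (ℤ→ℚ-nonNeg⇒ℕ (n j) (n≥0 j))
    n≡m : ∀ j → n j ≡ ℤ.+ m j
    n≡m j = proj₂ (ℤ→ℚ-nonNeg⇒ℕ (n j) (n≥0 j))

lemma3p3 : ∀ {r : ℕ} (R : RootSystem r) (μ λ' : V r) →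
    InCorootLattice R μ → InCorootLattice R λ' →
    (_≤a_ R (t R μ) (t R λ') → _⪯_ R μ λ') × (_⪯_ R μ λ' → _≤a_ R (t R μ) (t R λ'))
lemma3p3 R μ λ′ μ∈ℤΦ^∨ λ∈ℤΦ^∨ = ≤a⇒⪯ R μ λ′ μ∈ℤΦ^∨ λ∈ℤΦ^∨ , ⪯⇒≤a R μ λ′ μ∈ℤΦ^∨
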